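{- $\pi\sqsubseteq\pi^{\vee}$ and $\pi^{\vee}\sqsubseteq\pi$.
   Context: Fix disjoint countably infinite sets $\mathcal{N}$ of names ($a,b,c,\dots$) and $\mathcal{N}_v$ of name variables ($x,y,z,\dots$); $n,m,p,q$ range over both. $\pi$-terms: $T ::= \mathbf{0} \mid \sum_{i\in I} n(x).T_i \mid \sum_{i\in I}\overline{n}m_i.T_i \mid S\,|\,T \mid (c)T \mid [p{=}q]T \mid [p{\neq}q]T \mid\ !\pi.T$, $\pi ::= n(x)\mid \overline{n}m$, $I$ finite nonempty; $x$ bound in $n(x).T$, $c$ local in $(c)T$, terms up to $\alpha$-conversion; processes are terms without free name variables. Labels $ab,\overline{a}b,\overline{a}(c)$; actions: labels and $\tau$. Transitions: $\sum_i a(x).T_i\xrightarrow{ac}T_i\{c/x\}$ (any $i$, any name $c$); $\sum_i\overline{a}c_i.T_i\xrightarrow{\overline{a}c_i}T_i$; parallel interleaving in both arguments; $S\xrightarrow{ab}S'$, $T\xrightarrow{\overline{a}b}T'$ give $S|T\xrightarrow{\tau}S'|T'$; $S\xrightarrow{ac}S'$, $T\xrightarrow{\overline{a}(c)}T'$ give $S|T\xrightarrow{\tau}(c)(S'|T')$ (and symmetric versions); $T\xrightarrow{\overline{a}c}T'$ gives $(c)T\xrightarrow{\overline{a}(c)}T'$; $T\xrightarrow{\lambda}T'$ with $c\notin\lambda$ gives $(c)T\xrightarrow{\lambda}(c)T'$; $[a{=}a]T$ and $[a{\neq}b]T$ ($a\neq b$ names) have the transitions of $T$; $!\overline{a}b.T\xrightarrow{\overline{a}b}T|!\overline{a}b.T$,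 $!a(x).T\xrightarrow{ab}T\{b/x\}|!a(x).T$. The calculus $\pi^{\vee}$ is $\pi$ with the match and mismatch operators replaced by an operator $[\varphi]T$, where $\varphi$ is a boolean expression built from atomic equations $p{=}q$ with $\wedge$ and $\neg$; when $\varphi$ contains only names and is true (distinct names being unequal), $[\varphi]T$ has the transitions of $T$, and otherwise it has none. $\Longrightarrow$: reflexive transitive closure of $\xrightarrow{\tau}$; $\stackrel{\tau}{\Longrightarrow}$: $\Longrightarrow\xrightarrow{\tau}\Longrightarrow$; $P\Downarrow$ iff $P\Longrightarrow\xrightarrow{\ell}$ for a label $\ell$. For calculi $\mathbb{L},\mathbb{M}$, a relation $\Re$ from $\mathbb{L}$-processes to $\mathbb{M}$-processes is: equipollent if $P\Re Q\Rightarrow(P\Downarrow\iff Q\Downarrow)$; extensional if $L\Re M$, $P\Re Q$ imply $(L|P)\Re(M|Q)$ and $P\Re Q$ implies $(c)P\Re(c)Q$; codivergent if whenever $P\Re Q$ and $Q\xrightarrow{\tau}Q_1\xrightarrow{\tau}\cdots$ is infinite there are $k\ge1$, $P'$ with $P\stackrel{\tau}{\Longrightarrow}P'\Re Q_k$, and symmetrically for infinite $\tau$-sequences of $P$; a bisimulation if whenever $P\Re Q\xrightarrow{\tau}Q'$ then either $P\Longrightarrow P'$ with $P'\Re Q$, $P'\Re Q'$, or $P\Longrightarrow P''\xrightarrow{\tau}P'$ with $P''\Re Q$, $P'\Re Q'$, and symmetrically whenever $P\xrightarrow{\tau}P'$. The absolute equality $=_{\mathbb{M}}$ of $\mathbb{M}$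 is the largest reflexive relation on $\mathbb{M}$-processes that is equipollent, extensional, codivergent and a bisimulation. A subbisimilarity from $\mathbb{L}$ to $\mathbb{M}$ is a relation $\Re$ that is total (every $\mathbb{L}$-process is related to some $\mathbb{M}$-process), sound ($M_1\Re^{ -1}L_1=_{\mathbb{L}}L_2\Re M_2$ implies $M_1=_{\mathbb{M}}M_2$), equipollent, extensional, codivergent and a bisimulation. $\mathbb{L}\sqsubseteq\mathbb{M}$ means there is a subbisimilarity from $\mathbb{L}$ to $\mathbb{M}$. -}

module Defs where

open import Data.Nat using (ℕ; zero; suc; _≤_; _≡ᵇ_)
open import Data.Fin using (Fin; zero; suc)
open import Data.Bool using (Bool; true; false; if_then_else_; _∧_; not)
open import Data.Maybe using (Maybe; just; nothing)
open import Data.Product using (Σ; ∃; ∃₂; _×_; _,_)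
open import Data.Sum using (_⊎_)
open import Data.Empty using (⊥)
open import Data.Unit using (⊤)
open import Relation.Nullary using (¬_)
open import Relation.Binary.PropositionalEquality using (_≡_; _≢_)
open import Relation.Binary.Construct.Closure.ReflexiveTransitive using (Star)

-- Atoms (names and name variables), locally nameless representation.
-- Terms are up to α-conversion: binders (input prefix binding a name
-- variable x, localization (c) binding a name c) are represented by
-- de Bruijn indices 'bv'.  'nm a' is a (free) name, 'var x' a free name
-- variable.  'Term n' = terms under n enclosing binders.

data At (n : ℕ) : Set where
  nm  : ℕ → At n
  var : ℕ → At n
  bv  : Fin n → At n

wkA : ∀ {n} → At n → At (suc n)
wkA (nm a)  = nm a
wkA (var x) = var x
wkA (bv i)  = bv (suc i)

extA : ∀ {n m} → (At n → At m) → At (suc n) → At (suc m)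
extA σ (bv zero)    = bv zero
extA σ (bv (suc i)) = wkA (σ (bv i))
extA σ (nm a)       = wkA (σ (nm a))
extA σ (var x)      = wkA (σ (var x))

instA : ℕ → At 1 → At 0
instA c (bv zero) = nm c
instA c (nm a)    = nm a
instA c (var x)   = var x

absA : ℕ → At 0 → At 1
absA c (nm a)  = if a ≡ᵇ c then bv zero else nm a
absA c (var x) = var x

isNm : ℕ → ∀ {n} → At n → Set
isNm c (nm a) = a ≡ c
isNm c _      = ⊥

isVar : ∀ {n} → At n → Set
isVar (var _) = ⊤
isVar _       = ⊥

data Label : Set where
  inL   : ℕ → ℕ → Label
  outL  : ℕ → ℕ → Label
  boutL : ℕ → ℕ → Label

data Act : Set where
  lab : Label → Act
  τ   : Act

_∉act_ : ℕ → Act → Set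
c ∉act lab (inL a b)   = c ≢ a × c ≢ b
c ∉act lab (outL a b)  = c ≢ a × c ≢ b
c ∉act lab (boutL a b) = c ≢ a × c ≢ b
c ∉act τ               = ⊤

record Calc : Set₁ where
  field
    Tm     : Set
    IsProc : Tm → Set                 -- no free name variables
    _⟶[_]_ : Tm → Act → Tm → Set
    _∥_    : Tm → Tm → Tm
    ν      : ℕ → Tm → Tm

module Calculus
  (C     : ℕ → Set)
  (mapC  : ∀ {n m} → (At n → At m) → C n → C m)
  (occC  : (∀ {n} → At n → Set) → ∀ {n} → C n → Set)
  (holds : C 0 → Set)
  where

  data Term (n : ℕ) : Set where
    nil    : Term n
    -- Σ_{i ∈ I} p(x).T_i ,  I = Fin (suc k) finite nonempty
    inpSum : At n → (k : ℕ) → (Fin (suc k) → Term (suc n)) → Term n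
    outSum : At n → (k : ℕ) → (Fin (suc k) → At n) → (Fin (suc k) → Term n) → Term n
    par    : Term n → Term n → Term n
    res    : Term (suc n) → Term n
    cnd    : C n → Term n → Term n
    repIn  : At n → Term (suc n) → Term n
    repOut : At n → At n → Term n → Term n

  sub : ∀ {n m} → (At n → At m) → Term n → Term m
  sub σ nil              = nil
  sub σ (inpSum p k f)   = inpSum (σ p) k (λ i → sub (extA σ) (f i))
  sub σ (outSum p k o f) = outSum (σ p) k (λ i → σ (o i)) (λ i → sub σ (f i))
  sub σ (par S T)        = par (sub σ S) (sub σ T)
  sub σ (res B)          = res (sub (extA σ) B)
  sub σ (cnd φ T)        = cnd (mapC σ φ) (sub σ T)
  sub σ (repIn p B)      = repIn (σ p) (sub (extA σ) B)
  sub σ (repOut p q T)   = repOut (σ p) (σ q) (sub σ T)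

  openT : ℕ → Term 1 → Term 0
  openT c = sub (instA c)

  closeT : ℕ → Term 0 → Term 1
  closeT c = sub (absA c)

  νT : ℕ → Term 0 → Term 0
  νT c T = res (closeT c T)

  Occ : (∀ {n} → At n → Set) → ∀ {n} → Term n → Set
  Occ P nil              = ⊥
  Occ P (inpSum p k f)   = P p ⊎ Σ (Fin (suc k)) (λ i → Occ P (f i))
  Occ P (outSum p k o f) = P p ⊎ Σ (Fin (suc k)) (λ i → P (o i) ⊎ Occ P (f i))
  Occ P (par S T)        = Occ P S ⊎ Occ P T
  Occ P (res B)          = Occ P B
  Occ P (cnd φ T)        = occC P φ ⊎ Occ P T
  Occ P (repIn p B)      = P p ⊎ Occ P B
  Occ P (repOut p q T)   = P p ⊎ (P q ⊎ Occ P T)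

  Fresh : ℕ → ∀ {n} → Term n → Set
  Fresh c T = ¬ Occ (isNm c) T

  IsProc : Term 0 → Set
  IsProc T = ¬ Occ isVar T

  BoundOK : Act → Term 0 → Set
  BoundOK (lab (boutL a c)) T = Fresh c T
  BoundOK _ T = ⊤

  data _⟶[_]_ : Term 0 → Act → Term 0 → Set where
    inp   : ∀ {a k f} (i : Fin (suc k)) (c : ℕ) →
            inpSum (nm a) k f ⟶[ lab (inL a c) ] openT c (f i)
    out   : ∀ {a k o f b} (i : Fin (suc k)) → o i ≡ nm b →
            outSum (nm a) k o f ⟶[ lab (outL a b) ] f i
    parL  : ∀ {S S' T α} → S ⟶[ α ] S' → BoundOK α T → par S T ⟶[ α ] par S' T
    parR  : ∀ {S T T' α} → T ⟶[ α ] T' → BoundOK α S → par S T ⟶[ α ] par S T'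
    comL  : ∀ {S S' T T' a b} → S ⟶[ lab (inL a b) ] S' → T ⟶[ lab (outL a b) ] T' →
            par S T ⟶[ τ ] par S' T'
    comR  : ∀ {S S' T T' a b} → S ⟶[ lab (outL a b) ] S' → T ⟶[ lab (inL a b) ] T' →
            par S T ⟶[ τ ] par S' T'
    closL : ∀ {S S' T T' a c} → S ⟶[ lab (inL a c) ] S' → T ⟶[ lab (boutL a c) ] T' →
            Fresh c S → par S T ⟶[ τ ] νT c (par S' T')
    closR : ∀ {S S' T T' a c} → S ⟶[ lab (boutL a c) ] S' → T ⟶[ lab (inL a c) ] T' →
            Fresh c T → par S T ⟶[ τ ] νT c (par S' T')
    opn   : ∀ {B T' a c} → Fresh c B → a ≢ c → openT c B ⟶[ lab (outL a c) ] T' →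
            res B ⟶[ lab (boutL a c) ] T'
    resS  : ∀ {B T' α c} → Fresh c B → openT c B ⟶[ α ] T' → c ∉act α →
            res B ⟶[ α ] νT c T'
    cond  : ∀ {φ T T' α} → holds φ → T ⟶[ α ] T' → cnd φ T ⟶[ α ] T'
    repO  : ∀ {a b T} → repOut (nm a) (nm b) T ⟶[ lab (outL a b) ] par T (repOut (nm a) (nm b) T)
    repI  : ∀ {a B} (b : ℕ) → repIn (nm a) B ⟶[ lab (inL a b) ] par (openT b B) (repIn (nm a) B)

  calc : Calc
  calc = record { Tm = Term 0 ; IsProc = IsProc ; _⟶[_]_ = _⟶[_]_ ; _∥_ = par ; ν = νT }

data MM (n : ℕ) : Set where
  eqC  : At n → At n → MM n
  neqC : At n → At n → MM n

mapMM : ∀ {n m} → (At n → At m) → MM n → MM m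
mapMM σ (eqC p q)  = eqC (σ p) (σ q)
mapMM σ (neqC p q) = neqC (σ p) (σ q)

occMM : (∀ {n} → At n → Set) → ∀ {n} → MM n → Set
occMM P (eqC p q)  = P p ⊎ P q
occMM P (neqC p q) = P p ⊎ P q

holdsMM : MM 0 → Set
holdsMM (eqC (nm a) (nm b))  = a ≡ b
holdsMM (neqC (nm a) (nm b)) = a ≢ b
holdsMM _                    = ⊥

module Pi = Calculus MM mapMM occMM holdsMM

πCalc : Calc
πCalc = Pi.calc

data Fm (n : ℕ) : Set where
  eqF  : At n → At n → Fm n
  andF : Fm n → Fm n → Fm n
  notF : Fm n → Fm n

mapFm : ∀ {n m} → (At n → At m) → Fm n → Fm m
mapFm σ (eqF p q)  = eqF (σ p) (σ q)
mapFm σ (andF φ ψ) = andF (mapFm σ φ) (mapFm σ ψ)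
mapFm σ (notF φ)   = notF (mapFm σ φ)

occFm : (∀ {n} → At n → Set) → ∀ {n} → Fm n → Set
occFm P (eqF p q)  = P p ⊎ P q
occFm P (andF φ ψ) = occFm P φ ⊎ occFm P ψ
occFm P (notF φ)   = occFm P φ

-- value of a condition: nothing if it contains a name variable
evalFm : Fm 0 → Maybe Bool
evalFm (eqF (nm a) (nm b)) = just (a ≡ᵇ b)
evalFm (eqF _ _)           = nothing
evalFm (andF φ ψ) with evalFm φ | evalFm ψ
... | just u | just v = just (u ∧ v)
... | _      | _      = nothing
evalFm (notF φ) with evalFm φ
... | just u  = just (not u)
... | nothing = nothing

holdsFm : Fm 0 → Set
holdsFm φ = evalFm φ ≡ just true

module PiOr = Calculus Fm mapFm occFm holdsFm

πᵛCalc : Calc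
πᵛCalc = PiOr.calc

module _ (L : Calc) where
  open Calc L

  _⇛_ : Tm → Tm → Set
  _⇛_ = Star (λ P P' → P ⟶[ τ ] P')

  _⇛τ_ : Tm → Tm → Set
  P ⇛τ P' = ∃₂ λ P₁ P₂ → P ⇛ P₁ × P₁ ⟶[ τ ] P₂ × P₂ ⇛ P'

  _⇓ : Tm → Set
  P ⇓ = ∃₂ λ P' ℓ → P ⇛ P' × ∃ λ P'' → P' ⟶[ lab ℓ ] P''

  InfTau : Tm → (ℕ → Tm) → Set
  InfTau P s = s 0 ≡ P × (∀ i → s i ⟶[ τ ] s (suc i))

module _ (L M : Calc) where
  private
    module L = Calc L
    module M = Calc M

  HRel : Set₁
  HRel = L.Tm → M.Tm → Set

  OnProcs : HRel → Set
  OnProcs R = ∀ {P Q} → R P Q → L.IsProc P × M.IsProc Q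

  Equipollent : HRel → Set
  Equipollent R = ∀ {P Q} → R P Q → (_⇓ L P → _⇓ M Q) × (_⇓ M Q → _⇓ L P)

  Extensional : HRel → Set
  Extensional R =
    (∀ {L₁ M₁ P Q} → R L₁ M₁ → R P Q → R (L₁ L.∥ P) (M₁ M.∥ Q)) ×
    (∀ {P Q} (c : ℕ) → R P Q → R (L.ν c P) (M.ν c Q))

  Codivergent : HRel → Set
  Codivergent R =
    (∀ {P Q} (s : ℕ → M.Tm) → R P Q → InfTau M Q s →
       ∃ λ k → 1 ≤ k × ∃ λ P' → _⇛τ_ L P P' × R P' (s k)) ×
    (∀ {P Q} (s : ℕ → L.Tm) → R P Q → InfTau L P s →
       ∃ λ k → 1 ≤ k × ∃ λ Q' → _⇛τ_ M Q Q' × R (s k) Q')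

  Bisimulation : HRel → Set
  Bisimulation R =
    (∀ {P Q Q'} → R P Q → Q M.⟶[ τ ] Q' →
       (∃ λ P' → _⇛_ L P P' × R P' Q × R P' Q') ⊎
       (∃₂ λ P'' P' → _⇛_ L P P'' × P'' L.⟶[ τ ] P' × R P'' Q × R P' Q')) ×
    (∀ {P Q P'} → R P Q → P L.⟶[ τ ] P' →
       (∃ λ Q' → _⇛_ M Q Q' × R P Q' × R P' Q') ⊎
       (∃₂ λ Q'' Q' → _⇛_ M Q Q'' × Q'' M.⟶[ τ ] Q' × R P Q'' × R P' Q'))

AbsEq : (M : Calc) → Calc.Tm M → Calc.Tm M → Set₁
AbsEq M P Q = Σ (HRel M M) λ R →
  OnProcs M M R ×
  (∀ P₀ → Calc.IsProc M P₀ → R P₀ P₀) ×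
  Equipollent M M R × Extensional M M R × Codivergent M M R ×
  Bisimulation M M R × R P Q

Subbisimilarity : (L M : Calc) → HRel L M → Set₁
Subbisimilarity L M R =
  OnProcs L M R ×
  (∀ P → Calc.IsProc L P → ∃ λ Q → R P Q) ×
  (∀ {M₁ L₁ L₂ M₂} → R L₁ M₁ → AbsEq L L₁ L₂ → R L₂ M₂ → AbsEq M M₁ M₂) ×
  Equipollent L M R × Extensional L M R × Codivergent L M R × Bisimulation L M R

_⊑_ : Calc → Calc → Set₁
L ⊑ M = Σ (HRel L M) (Subbisimilarity L M)

-- Push negations in a condition of πᵛ down to the equations and encode [¬(φ ∧ ψ)]T as
-- [¬φ]([ψ]T | [¬ψ]T) | [φ][¬ψ]T: whatever the values of φ and ψ, exactly one copy of T is
-- enabled and the other parallel components can never act.  Relating each πᵛ term to this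
-- match/mismatch encoding, up to such dead components, gives a relation that matches single
-- τ-steps and immediate barbs in both directions, relates every process of either calculus
-- (a π process corresponds to itself read as a πᵛ process), and is closed under parallel
-- composition and restriction.  Any such strong correspondence R is a subbisimilarity in both
-- directions; for soundness, an absolute-equality witness S on one side is carried to R⁻¹ S R
-- on the other.

module Submission where

open import Defs
open import Data.Nat using (ℕ; zero; suc; _≡ᵇ_; _≟_; _≤_; _<_; _⊔_; s≤s; z≤n; s≤s⁻¹)
open import Data.Nat.Properties
  using ( ≡ᵇ⇒≡; ≡⇒≡ᵇ; ≤-refl; ≤-trans; <-trans; <-≤-trans; n<1+n; <⇒≢
        ; m≤m⊔n; m≤n⊔m; m≤n⇒m≤n⊔o; m≤n⇒m≤o⊔n; m⊔n<o⇒m<o; m⊔n<o⇒n<o )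
open import Data.Fin using (Fin; zero; suc)
open import Data.Bool using (Bool; true; false; not; _∧_; T)
open import Data.Bool.Properties using (not-involutive; T-≡)
open import Data.Maybe using (Maybe; just)
open import Data.Maybe.Properties using (just-injective)
open import Data.Product using (Σ; ∃; _×_; _,_; proj₁; proj₂)
open import Data.Sum using (_⊎_; inj₁; inj₂; [_,_]) renaming (map to ⊎-map)
open import Data.Empty using (⊥; ⊥-elim)
open import Data.Unit using (tt)
open import Function using (_∘_)
open import Function.Bundles using (Equivalence)
open import Relation.Nullary using (¬_; yes; no)
open import Relation.Nullary.Decidable using (dec-true; dec-false)
open import Relation.Binary.PropositionalEquality
  using (_≡_; _≢_; refl; sym; trans; cong; cong₂; subst; ≢-sym)
open import Relation.Binary.Construct.Closure.ReflexiveTransitive using (ε; _◅_)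

-- Strong correspondences

Barb : (L : Calc) → Calc.Tm L → Set
Barb L P = ∃ λ ℓ → ∃ λ P' → Calc._⟶[_]_ L P (lab ℓ) P'

record StrongCorrespondence (L M : Calc) (R : HRel L M) : Set where
  private
    module L = Calc L
    module M = Calc M
  field
    onProcs    : OnProcs L M R
    total      : ∀ P → L.IsProc P → ∃ λ Q → R P Q
    surjective : ∀ Q → M.IsProc Q → ∃ λ P → R P Q
    forth      : ∀ {P Q P'} → R P Q → P L.⟶[ τ ] P' → ∃ λ Q' → Q M.⟶[ τ ] Q' × R P' Q'
    back       : ∀ {P Q Q'} → R P Q → Q M.⟶[ τ ] Q' → ∃ λ P' → P L.⟶[ τ ] P' × R P' Q'
    barb-forth : ∀ {P Q} → R P Q → Barb L P → Barb M Q
    barb-back  : ∀ {P Q} → R P Q → Barb M Q → Barb L P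
    par-closed : ∀ {L₁ M₁ P Q} → R L₁ M₁ → R P Q → R (L₁ L.∥ P) (M₁ M.∥ Q)
    ν-closed   : ∀ {P Q} (c : ℕ) → R P Q → R (L.ν c P) (M.ν c Q)

StrongCorrespondence-flip : ∀ {L M R} → StrongCorrespondence L M R →
                            StrongCorrespondence M L (λ Q P → R P Q)
StrongCorrespondence-flip sc = record
  { onProcs    = λ r → proj₂ (onProcs r) , proj₁ (onProcs r)
  ; total      = surjective
  ; surjective = total
  ; forth      = back
  ; back       = forth
  ; barb-forth = barb-back
  ; barb-back  = barb-forth
  ; par-closed = par-closed
  ; ν-closed   = ν-closed
  }
  where open StrongCorrespondence sc

module _ {L M : Calc} {R : HRel L M} (sc : StrongCorrespondence L M R) where
  open StrongCorrespondence sc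
  private
    module L = Calc L
    module M = Calc M

  forth⋆ : ∀ {P Q P'} → R P Q → _⇛_ L P P' → ∃ λ Q' → _⇛_ M Q Q' × R P' Q'
  forth⋆ r ε = _ , ε , r
  forth⋆ r (s ◅ ss) with forth r s
  ... | _ , s' , r₁ with forth⋆ r₁ ss
  ...   | _ , ss' , r' = _ , s' ◅ ss' , r'

  back⋆ : ∀ {P Q Q'} → R P Q → _⇛_ M Q Q' → ∃ λ P' → _⇛_ L P P' × R P' Q'
  back⋆ r ε = _ , ε , r
  back⋆ r (s ◅ ss) with back r s
  ... | _ , s' , r₁ with back⋆ r₁ ss
  ...   | _ , ss' , r' = _ , s' ◅ ss' , r'

  forthτ⋆ : ∀ {P Q P'} → R P Q → _⇛τ_ L P P' → ∃ λ Q' → _⇛τ_ M Q Q' × R P' Q'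
  forthτ⋆ r (_ , _ , ss₁ , s , ss₂) with forth⋆ r ss₁
  ... | _ , ss₁' , r₁ with forth r₁ s
  ...   | _ , s' , r₂ with forth⋆ r₂ ss₂
  ...     | _ , ss₂' , r' = _ , (_ , _ , ss₁' , s' , ss₂') , r'

  equipollent : Equipollent L M R
  equipollent r =
    (λ (_ , ℓ , ss , P'' , s) → let _ , ss' , r' = forth⋆ r ss
                                    ℓ' , Q'' , s' = barb-forth r' (ℓ , P'' , s)
                                in _ , ℓ' , ss' , Q'' , s') ,
    (λ (_ , ℓ , ss , Q'' , s) → let _ , ss' , r' = back⋆ r ss
                                    ℓ' , P'' , s' = barb-back r' (ℓ , Q'' , s)
                                in _ , ℓ' , ss' , P'' , s')

  codivergent : Codivergent L M R
  codivergent = back-first , forth-first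
    where
    back-first : ∀ {P Q} (s : ℕ → M.Tm) → R P Q → InfTau M Q s →
                 ∃ λ k → 1 ≤ k × ∃ λ P' → _⇛τ_ L P P' × R P' (s k)
    back-first {P} s r (refl , steps) =
      let P' , s' , r' = back r (steps 0) in 1 , s≤s z≤n , P' , (P , P' , ε , s' , ε) , r'
    forth-first : ∀ {P Q} (s : ℕ → L.Tm) → R P Q → InfTau L P s →
                  ∃ λ k → 1 ≤ k × ∃ λ Q' → _⇛τ_ M Q Q' × R (s k) Q'
    forth-first {Q = Q} s r (refl , steps) =
      let Q' , s' , r' = forth r (steps 0) in 1 , s≤s z≤n , Q' , (Q , Q' , ε , s' , ε) , r'

  bisimulation : Bisimulation L M R
  bisimulation =
    (λ {P} r s → let P' , s' , r' = back r s in inj₂ (P , P' , ε , s' , r , r')) ,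
    (λ {Q = Q} r s → let Q' , s' , r' = forth r s in inj₂ (Q , Q' , ε , s' , r , r'))

  back-sequence : ∀ {P Q} (s : ℕ → M.Tm) → R P Q → InfTau M Q s → ∀ i → ∃ λ P' → R P' (s i)
  back-sequence s r (refl , steps) zero    = _ , r
  back-sequence s r (refl , steps) (suc i) =
    let _ , r' = back-sequence s r (refl , steps) i
        P' , _ , r″ = back r' (steps i)
    in P' , r″

  back-sequence-InfTau : ∀ {P Q} (s : ℕ → M.Tm) (r : R P Q) (inf : InfTau M Q s) →
                         InfTau L P (proj₁ ∘ back-sequence s r inf)
  back-sequence-InfTau s r (refl , steps) =
    refl , λ i → proj₁ (proj₂ (back (proj₂ (back-sequence s r (refl , steps) i)) (steps i)))

  Image : HRel L L → HRel M M
  Image S X Y = ∃ λ A → ∃ λ B → R A X × S A B × R B Y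

  module _ {S : HRel L L} where

    Image-equipollent : Equipollent L L S → Equipollent M M (Image S)
    Image-equipollent eq (A , B , ra , sab , rb) =
      proj₁ (equipollent rb) ∘ proj₁ (eq sab) ∘ proj₂ (equipollent ra) ,
      proj₁ (equipollent ra) ∘ proj₂ (eq sab) ∘ proj₂ (equipollent rb)

    Image-extensional : Extensional L L S → Extensional M M (Image S)
    Image-extensional (S-par , S-ν) =
      (λ (_ , _ , ra , sab , rb) (_ , _ , ra' , sab' , rb') →
         _ , _ , par-closed ra ra' , S-par sab sab' , par-closed rb rb') ,
      (λ c (_ , _ , ra , sab , rb) → _ , _ , ν-closed c ra , S-ν c sab , ν-closed c rb)

    Image-codivergent : Codivergent L L S → Codivergent M M (Image S)
    Image-codivergent (S-cd₁ , S-cd₂) =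
      (λ s (A , B , ra , sab , rb) inf →
         let lifted = back-sequence s rb inf
             k , 1≤k , A' , ss , sab' = S-cd₁ (proj₁ ∘ lifted) sab (back-sequence-InfTau s rb inf)
             X' , ss' , ra' = forthτ⋆ ra ss
         in k , 1≤k , X' , ss' , (A' , proj₁ (lifted k) , ra' , sab' , proj₂ (lifted k))) ,
      (λ s (A , B , ra , sab , rb) inf →
         let lifted = back-sequence s ra inf
             k , 1≤k , B' , ss , sab' = S-cd₂ (proj₁ ∘ lifted) sab (back-sequence-InfTau s ra inf)
             Y' , ss' , rb' = forthτ⋆ rb ss
         in k , 1≤k , Y' , ss' , (proj₁ (lifted k) , B' , proj₂ (lifted k) , sab' , rb'))

    Image-bisimulation : Bisimulation L L S → Bisimulation M M (Image S)
    Image-bisimulation (S-bis₁ , S-bis₂) =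
      (λ (A , B , ra , sab , rb) s →
         let B' , sB , rb' = back rb s in
         [ (λ (A' , ss , sab₁ , sab₂) →
              let X' , ss' , ra' = forth⋆ ra ss in
              inj₁ (X' , ss' , (A' , B , ra' , sab₁ , rb) , (A' , B' , ra' , sab₂ , rb')))
         , (λ (A'' , A' , ss , s' , sab₁ , sab₂) →
              let X'' , ss' , ra'' = forth⋆ ra ss
                  X' , s'' , ra' = forth ra'' s' in
              inj₂ (X'' , X' , ss' , s'' ,
                    (A'' , B , ra'' , sab₁ , rb) , (A' , B' , ra' , sab₂ , rb')))
         ] (S-bis₁ sab sB)) ,
      (λ (A , B , ra , sab , rb) s →
         let A' , sA , ra' = back ra s in
         [ (λ (B' , ss , sab₁ , sab₂) →
              let Y' , ss' , rb' = forth⋆ rb ss in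
              inj₁ (Y' , ss' , (A , B' , ra , sab₁ , rb') , (A' , B' , ra' , sab₂ , rb')))
         , (λ (B'' , B' , ss , s' , sab₁ , sab₂) →
              let Y'' , ss' , rb'' = forth⋆ rb ss
                  Y' , s'' , rb' = forth rb'' s' in
              inj₂ (Y'' , Y' , ss' , s'' ,
                    (A , B'' , ra , sab₁ , rb'') , (A' , B' , ra' , sab₂ , rb')))
         ] (S-bis₂ sab sA))

  sound : ∀ {M₁ L₁ L₂ M₂} → R L₁ M₁ → AbsEq L L₁ L₂ → R L₂ M₂ → AbsEq M M₁ M₂
  sound {L₁ = L₁} {L₂} r₁ (S , _ , S-refl , S-eq , S-ext , S-cd , S-bis , s₁₂) r₂ =
    Image S ,
    (λ (_ , _ , ra , _ , rb) → proj₂ (onProcs ra) , proj₂ (onProcs rb)) ,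
    (λ Q q → let A , ra = surjective Q q in A , A , ra , S-refl A (proj₁ (onProcs ra)) , ra) ,
    Image-equipollent S-eq , Image-extensional S-ext ,
    Image-codivergent S-cd , Image-bisimulation S-bis ,
    (L₁ , L₂ , r₁ , s₁₂ , r₂)

  StrongCorrespondence⇒⊑ : L ⊑ M
  StrongCorrespondence⇒⊑ =
    R , onProcs , total , sound , equipollent , (par-closed , ν-closed) , codivergent , bisimulation

-- Occurrences of atoms and substitution

-- Predicates on atoms are given by codes so that the substitution lemmas can inspect them.
data AtomPred : Set where
  isVarᵖ : AtomPred
  isNmᵖ  : ℕ → AtomPred
  noneᵖ  : AtomPred

⟦_⟧ : AtomPred → ∀ {n} → At n → Set
⟦ isVarᵖ ⟧  = isVar
⟦ isNmᵖ c ⟧ = isNm c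
⟦ noneᵖ ⟧   = λ _ → ⊥

⟦⟧-bv : ∀ P {n} (i : Fin n) → ¬ ⟦ P ⟧ (bv i)
⟦⟧-bv isVarᵖ    i ()
⟦⟧-bv (isNmᵖ c) i ()
⟦⟧-bv noneᵖ     i ()

⟦⟧-nm : ∀ P {n m} a → ⟦ P ⟧ {n} (nm a) → ⟦ P ⟧ {m} (nm a)
⟦⟧-nm isVarᵖ    a ()
⟦⟧-nm (isNmᵖ c) a h = h
⟦⟧-nm noneᵖ     a ()

⟦⟧-var : ∀ P {n m} x → ⟦ P ⟧ {n} (var x) → ⟦ P ⟧ {m} (var x)
⟦⟧-var isVarᵖ    x h = tt
⟦⟧-var (isNmᵖ c) x ()
⟦⟧-var noneᵖ     x ()

⟦⟧-wk : ∀ P {n} (x : At n) → ⟦ P ⟧ x → ⟦ P ⟧ (wkA x)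
⟦⟧-wk P (nm a)  = ⟦⟧-nm P a
⟦⟧-wk P (var x) = ⟦⟧-var P x
⟦⟧-wk P (bv i) h = ⊥-elim (⟦⟧-bv P i h)

⟦⟧-wk⁻¹ : ∀ P {n} (x : At n) → ⟦ P ⟧ (wkA x) → ⟦ P ⟧ x
⟦⟧-wk⁻¹ P (nm a)  = ⟦⟧-nm P a
⟦⟧-wk⁻¹ P (var x) = ⟦⟧-var P x
⟦⟧-wk⁻¹ P (bv i) h = ⊥-elim (⟦⟧-bv P (suc i) h)

Reflects : ∀ {n m} → AtomPred → AtomPred → (At n → At m) → Set
Reflects P Q σ = ∀ p → ⟦ P ⟧ (σ p) → ⟦ Q ⟧ p

Reflects-extA : ∀ {n m} P Q (σ : At n → At m) → Reflects P Q σ → Reflects P Q (extA σ)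
Reflects-extA P Q σ h (bv zero)    x = ⊥-elim (⟦⟧-bv P zero x)
Reflects-extA P Q σ h (bv (suc i)) x = ⊥-elim (⟦⟧-bv Q i (h (bv i) (⟦⟧-wk⁻¹ P (σ (bv i)) x)))
Reflects-extA P Q σ h (nm a)       x = ⟦⟧-nm Q a (h (nm a) (⟦⟧-wk⁻¹ P (σ (nm a)) x))
Reflects-extA P Q σ h (var y)      x = ⟦⟧-var Q y (h (var y) (⟦⟧-wk⁻¹ P (σ (var y)) x))

absA-≡ : ∀ c → absA c (nm c) ≡ bv zero
absA-≡ c rewrite dec-true (c ≟ c) refl = refl

absA-≢ : ∀ {a c} → a ≢ c → absA c (nm a) ≡ nm a
absA-≢ {a} {c} a≢c rewrite dec-false (a ≟ c) a≢c = refl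

instA-reflects-var : ∀ c → Reflects isVarᵖ isVarᵖ (instA c)
instA-reflects-var c (var x) h = tt
instA-reflects-var c (bv zero) ()

absA-reflects-var : ∀ c → Reflects isVarᵖ isVarᵖ (absA c)
absA-reflects-var c (nm a) h with a ≡ᵇ c
... | true  = h
... | false = h
absA-reflects-var c (var x) h = tt

instA-reflects-nm : ∀ {c d} → c ≢ d → Reflects (isNmᵖ c) (isNmᵖ c) (instA d)
instA-reflects-nm c≢d (nm a)    h = h
instA-reflects-nm c≢d (bv zero) h = ⊥-elim (c≢d (sym h))

module Occurrence
  (C       : ℕ → Set)
  (mapC    : ∀ {n m} → (At n → At m) → C n → C m)
  (occC    : (∀ {n} → At n → Set) → ∀ {n} → C n → Set)
  (holds   : C 0 → Set)
  (occC-map  : ∀ {n m} P Q (σ : At n → At m) → Reflects P Q σ → (φ : C n) →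
               occC ⟦ P ⟧ (mapC σ φ) → occC ⟦ Q ⟧ φ)
  (¬occC-none : ∀ {n} (φ : C n) → ¬ occC ⟦ noneᵖ ⟧ φ)
  where
  open Calculus C mapC occC holds

  ¬Occ-none : ∀ {n} (T : Term n) → ¬ Occ ⟦ noneᵖ ⟧ T
  ¬Occ-none (inpSum p k f)   (inj₂ (i , x))      = ¬Occ-none (f i) x
  ¬Occ-none (outSum p k o f) (inj₂ (i , inj₂ x)) = ¬Occ-none (f i) x
  ¬Occ-none (par S T)        (inj₁ x)            = ¬Occ-none S x
  ¬Occ-none (par S T)        (inj₂ x)            = ¬Occ-none T x
  ¬Occ-none (res B)          x                   = ¬Occ-none B x
  ¬Occ-none (cnd φ T)        (inj₁ x)            = ¬occC-none φ x
  ¬Occ-none (cnd φ T)        (inj₂ x)            = ¬Occ-none T x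
  ¬Occ-none (repIn p B)      (inj₂ x)            = ¬Occ-none B x
  ¬Occ-none (repOut p q T)   (inj₂ (inj₂ x))     = ¬Occ-none T x

  Occ-sub : ∀ {n m} P Q (σ : At n → At m) → Reflects P Q σ → (T : Term n) →
            Occ ⟦ P ⟧ (sub σ T) → Occ ⟦ Q ⟧ T
  Occ-sub P Q σ h (inpSum p k f)   (inj₁ x)            = inj₁ (h p x)
  Occ-sub P Q σ h (inpSum p k f)   (inj₂ (i , x))      =
    inj₂ (i , Occ-sub P Q (extA σ) (Reflects-extA P Q σ h) (f i) x)
  Occ-sub P Q σ h (outSum p k o f) (inj₁ x)            = inj₁ (h p x)
  Occ-sub P Q σ h (outSum p k o f) (inj₂ (i , inj₁ x)) = inj₂ (i , inj₁ (h (o i) x))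
  Occ-sub P Q σ h (outSum p k o f) (inj₂ (i , inj₂ x)) = inj₂ (i , inj₂ (Occ-sub P Q σ h (f i) x))
  Occ-sub P Q σ h (par S T)        (inj₁ x)            = inj₁ (Occ-sub P Q σ h S x)
  Occ-sub P Q σ h (par S T)        (inj₂ x)            = inj₂ (Occ-sub P Q σ h T x)
  Occ-sub P Q σ h (res B)          x                   = Occ-sub P Q (extA σ) (Reflects-extA P Q σ h) B x
  Occ-sub P Q σ h (cnd φ T)        (inj₁ x)            = inj₁ (occC-map P Q σ h φ x)
  Occ-sub P Q σ h (cnd φ T)        (inj₂ x)            = inj₂ (Occ-sub P Q σ h T x)
  Occ-sub P Q σ h (repIn p B)      (inj₁ x)            = inj₁ (h p x)
  Occ-sub P Q σ h (repIn p B)      (inj₂ x)            =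
    inj₂ (Occ-sub P Q (extA σ) (Reflects-extA P Q σ h) B x)
  Occ-sub P Q σ h (repOut p q T)   (inj₁ x)            = inj₁ (h p x)
  Occ-sub P Q σ h (repOut p q T)   (inj₂ (inj₁ x))     = inj₂ (inj₁ (h q x))
  Occ-sub P Q σ h (repOut p q T)   (inj₂ (inj₂ x))     = inj₂ (inj₂ (Occ-sub P Q σ h T x))

  IsProc-openT : ∀ c B → IsProc (res B) → IsProc (openT c B)
  IsProc-openT c B p x = p (Occ-sub isVarᵖ isVarᵖ (instA c) (instA-reflects-var c) B x)

  IsProc-νT : ∀ c T → IsProc T → IsProc (νT c T)
  IsProc-νT c T p x = p (Occ-sub isVarᵖ isVarᵖ (absA c) (absA-reflects-var c) T x)

  Fresh-openT : ∀ {c d} B → c ≢ d → Fresh c B → Fresh c (openT d B)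
  Fresh-openT B c≢d p x = p (Occ-sub (isNmᵖ _) (isNmᵖ _) (instA _) (instA-reflects-nm c≢d) B x)

  IsProc-par : ∀ S T → IsProc S → IsProc T → IsProc (par S T)
  IsProc-par S T p q = [ p , q ]

  IsProc-⟶ : ∀ {T α T'} → T ⟶[ α ] T' → IsProc T → IsProc T'
  IsProc-⟶ (inp {f = f} i c) p x =
    p (inj₂ (i , Occ-sub isVarᵖ isVarᵖ (instA c) (instA-reflects-var c) (f i) x))
  IsProc-⟶ (out i e) p x = p (inj₂ (i , inj₂ x))
  IsProc-⟶ (parL {S' = S'} {T} d _) p = IsProc-par S' T (IsProc-⟶ d (p ∘ inj₁)) (p ∘ inj₂)
  IsProc-⟶ (parR {S} {T' = T'} d _) p = IsProc-par S T' (p ∘ inj₁) (IsProc-⟶ d (p ∘ inj₂))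
  IsProc-⟶ (comL {S' = S'} {T' = T'} d e) p =
    IsProc-par S' T' (IsProc-⟶ d (p ∘ inj₁)) (IsProc-⟶ e (p ∘ inj₂))
  IsProc-⟶ (comR {S' = S'} {T' = T'} d e) p =
    IsProc-par S' T' (IsProc-⟶ d (p ∘ inj₁)) (IsProc-⟶ e (p ∘ inj₂))
  IsProc-⟶ (closL {S' = S'} {T' = T'} {c = c} d e _) p =
    IsProc-νT c (par S' T') (IsProc-par S' T' (IsProc-⟶ d (p ∘ inj₁)) (IsProc-⟶ e (p ∘ inj₂)))
  IsProc-⟶ (closR {S' = S'} {T' = T'} {c = c} d e _) p =
    IsProc-νT c (par S' T') (IsProc-par S' T' (IsProc-⟶ d (p ∘ inj₁)) (IsProc-⟶ e (p ∘ inj₂)))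
  IsProc-⟶ (opn {B = B} {c = c} _ _ d) p = IsProc-⟶ d (IsProc-openT c B p)
  IsProc-⟶ (resS {B = B} {T' = T'} {c = c} _ d _) p = IsProc-νT c T' (IsProc-⟶ d (IsProc-openT c B p))
  IsProc-⟶ (cond h d) p = IsProc-⟶ d (p ∘ inj₂)
  IsProc-⟶ (repO {a} {b} {T}) p = IsProc-par T (repOut (nm a) (nm b) T) (p ∘ inj₂ ∘ inj₂) p
  IsProc-⟶ (repI {a} {B} b) p =
    IsProc-par (openT b B) (repIn (nm a) B)
               (p ∘ inj₂ ∘ Occ-sub isVarᵖ isVarᵖ (instA b) (instA-reflects-var b) B) p

  bout-≢ : ∀ {T T' a c} → T ⟶[ lab (boutL a c) ] T' → a ≢ c
  bout-≢ (parL d _)   = bout-≢ d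
  bout-≢ (parR d _)   = bout-≢ d
  bout-≢ (opn _ ne _) = ne
  bout-≢ (resS _ d _) = bout-≢ d
  bout-≢ (cond _ d)   = bout-≢ d

occMM-map : ∀ {n m} P Q (σ : At n → At m) → Reflects P Q σ → (l : MM n) →
            occMM ⟦ P ⟧ (mapMM σ l) → occMM ⟦ Q ⟧ l
occMM-map P Q σ h (eqC p q)  = ⊎-map (h p) (h q)
occMM-map P Q σ h (neqC p q) = ⊎-map (h p) (h q)

¬occMM-none : ∀ {n} (l : MM n) → ¬ occMM ⟦ noneᵖ ⟧ l
¬occMM-none (eqC p q)  (inj₁ ())
¬occMM-none (eqC p q)  (inj₂ ())
¬occMM-none (neqC p q) (inj₁ ())
¬occMM-none (neqC p q) (inj₂ ())

occFm-map : ∀ {n m} P Q (σ : At n → At m) → Reflects P Q σ → (φ : Fm n) →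
            occFm ⟦ P ⟧ (mapFm σ φ) → occFm ⟦ Q ⟧ φ
occFm-map P Q σ h (eqF p q)  = ⊎-map (h p) (h q)
occFm-map P Q σ h (andF φ ψ) = ⊎-map (occFm-map P Q σ h φ) (occFm-map P Q σ h ψ)
occFm-map P Q σ h (notF φ)   = occFm-map P Q σ h φ

¬occFm-none : ∀ {n} (φ : Fm n) → ¬ occFm ⟦ noneᵖ ⟧ φ
¬occFm-none (eqF p q)  (inj₁ ())
¬occFm-none (eqF p q)  (inj₂ ())
¬occFm-none (andF φ ψ) (inj₁ x) = ¬occFm-none φ x
¬occFm-none (andF φ ψ) (inj₂ x) = ¬occFm-none ψ x
¬occFm-none (notF φ)   x        = ¬occFm-none φ x

module π  = Pi
module πᵛ = PiOr
module Occπ  = Occurrence MM mapMM occMM holdsMM occMM-map ¬occMM-none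
module Occπᵛ = Occurrence Fm mapFm occFm holdsFm occFm-map ¬occFm-none

≡ᵇ⇒≡′ : ∀ {a b} → (a ≡ᵇ b) ≡ true → a ≡ b
≡ᵇ⇒≡′ {a} {b} e = ≡ᵇ⇒≡ a b (Equivalence.from T-≡ e)

≡ᵇ⇒≢ : ∀ {a b} → (a ≡ᵇ b) ≡ false → a ≢ b
≡ᵇ⇒≢ {a} e refl = subst T e (≡⇒≡ᵇ a a refl)

just-true≢just-false : ∀ {x : Maybe Bool} → x ≡ just true → x ≢ just false
just-true≢just-false refl ()

evalFm-andF⁻¹ : ∀ φ ψ {b} → evalFm (andF φ ψ) ≡ just b →
                Σ Bool λ u → Σ Bool λ v → evalFm φ ≡ just u × evalFm ψ ≡ just v × (u ∧ v) ≡ b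
evalFm-andF⁻¹ φ ψ e with evalFm φ | evalFm ψ
... | just u | just v = u , v , refl , refl , just-injective e

evalFm-andF : ∀ φ ψ {u v} → evalFm φ ≡ just u → evalFm ψ ≡ just v → evalFm (andF φ ψ) ≡ just (u ∧ v)
evalFm-andF φ ψ e₁ e₂ rewrite e₁ | e₂ = refl

evalFm-notF⁻¹ : ∀ φ {b} → evalFm (notF φ) ≡ just b → evalFm φ ≡ just (not b)
evalFm-notF⁻¹ φ e with evalFm φ
evalFm-notF⁻¹ φ refl | just u = cong just (sym (not-involutive u))

evalFm-notF : ∀ φ {b} → evalFm φ ≡ just (not b) → evalFm (notF φ) ≡ just b
evalFm-notF φ {b} e rewrite e = cong just (not-involutive b)

-- Encoding boolean conditions by match and mismatch

literal : ∀ {n} → Bool → At n → At n → MM n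
literal true  = eqC
literal false = neqC

-- guarded true φ Z encodes [φ]Z and guarded false φ Z encodes [¬φ]Z.
guarded : ∀ {n} → Bool → Fm n → π.Term n → π.Term n
guarded b     (eqF p q)  Z = π.cnd (literal b p q) Z
guarded b     (notF φ)   Z = guarded (not b) φ Z
guarded true  (andF φ ψ) Z = guarded true φ (guarded true ψ Z)
guarded false (andF φ ψ) Z =
  π.par (guarded false φ (π.par (guarded true ψ Z) (guarded false ψ Z)))
        (guarded true φ (guarded false ψ Z))

module _ {P : ∀ {k} → At k → Set} where

  Occ-guarded-body : ∀ {n} b (φ : Fm n) Z → π.Occ P Z → π.Occ P (guarded b φ Z)
  Occ-guarded-body true  (eqF p q)  Z x = inj₂ x
  Occ-guarded-body false (eqF p q)  Z x = inj₂ x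
  Occ-guarded-body b     (notF φ)   Z x = Occ-guarded-body (not b) φ Z x
  Occ-guarded-body true  (andF φ ψ) Z x = Occ-guarded-body true φ _ (Occ-guarded-body true ψ Z x)
  Occ-guarded-body false (andF φ ψ) Z x =
    inj₁ (Occ-guarded-body false φ _ (inj₁ (Occ-guarded-body true ψ Z x)))

  Occ-guarded-cond : ∀ {n} b (φ : Fm n) Z → occFm P φ → π.Occ P (guarded b φ Z)
  Occ-guarded-cond true  (eqF p q)  Z x = inj₁ x
  Occ-guarded-cond false (eqF p q)  Z x = inj₁ x
  Occ-guarded-cond b     (notF φ)   Z x = Occ-guarded-cond (not b) φ Z x
  Occ-guarded-cond true  (andF φ ψ) Z (inj₁ x) = Occ-guarded-cond true φ _ x
  Occ-guarded-cond true  (andF φ ψ) Z (inj₂ y) = Occ-guarded-body true φ _ (Occ-guarded-cond true ψ Z y)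
  Occ-guarded-cond false (andF φ ψ) Z (inj₁ x) = inj₁ (Occ-guarded-cond false φ _ x)
  Occ-guarded-cond false (andF φ ψ) Z (inj₂ y) =
    inj₁ (Occ-guarded-body false φ _ (inj₁ (Occ-guarded-cond true ψ Z y)))

  Occ-guarded⁻¹ : ∀ {n} b (φ : Fm n) Z → π.Occ P (guarded b φ Z) → occFm P φ ⊎ π.Occ P Z
  Occ-guarded⁻¹ true  (eqF p q)  Z x = x
  Occ-guarded⁻¹ false (eqF p q)  Z x = x
  Occ-guarded⁻¹ b     (notF φ)   Z x = Occ-guarded⁻¹ (not b) φ Z x
  Occ-guarded⁻¹ true  (andF φ ψ) Z x =
    [ inj₁ ∘ inj₁ , [ inj₁ ∘ inj₂ , inj₂ ] ∘ Occ-guarded⁻¹ true ψ Z ] (Occ-guarded⁻¹ true φ _ x)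
  Occ-guarded⁻¹ false (andF φ ψ) Z (inj₁ x) =
    [ inj₁ ∘ inj₁
    , [ [ inj₁ ∘ inj₂ , inj₂ ] ∘ Occ-guarded⁻¹ true ψ Z
      , [ inj₁ ∘ inj₂ , inj₂ ] ∘ Occ-guarded⁻¹ false ψ Z ] ]
    (Occ-guarded⁻¹ false φ _ x)
  Occ-guarded⁻¹ false (andF φ ψ) Z (inj₂ x) =
    [ inj₁ ∘ inj₁ , [ inj₁ ∘ inj₂ , inj₂ ] ∘ Occ-guarded⁻¹ false ψ Z ] (Occ-guarded⁻¹ true φ _ x)

Unsat : ∀ {n} → MM n → Set
Unsat (eqC p q)  = p ≢ q
Unsat (neqC p q) = p ≡ q

data Dead {n} : π.Term n → Set where
  dead-cnd   : ∀ {l T} → Unsat l → Dead (π.cnd l T)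
  dead-under : ∀ {l T} → Dead T → Dead (π.cnd l T)
  dead-par   : ∀ {G H} → Dead G → Dead H → Dead (π.par G H)

Unsat⇒¬holds : (l : MM 0) → Unsat l → ¬ holdsMM l
Unsat⇒¬holds (eqC (nm a) (nm b))   a≢b a≡b = a≢b (cong nm a≡b)
Unsat⇒¬holds (neqC (nm a) (nm .a)) refl a≢a = a≢a refl

Dead⇒inert : ∀ {G α G'} → Dead G → ¬ (G π.⟶[ α ] G')
Dead⇒inert (dead-cnd {l = l} u)  (π.cond h _)    = Unsat⇒¬holds l u h
Dead⇒inert (dead-under D)        (π.cond _ d)    = Dead⇒inert D d
Dead⇒inert (dead-par D _)        (π.parL d _)    = Dead⇒inert D d
Dead⇒inert (dead-par _ E)        (π.parR d _)    = Dead⇒inert E d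
Dead⇒inert (dead-par D _)        (π.comL d _)    = Dead⇒inert D d
Dead⇒inert (dead-par D _)        (π.comR d _)    = Dead⇒inert D d
Dead⇒inert (dead-par D _)        (π.closL d _ _) = Dead⇒inert D d
Dead⇒inert (dead-par D _)        (π.closR d _ _) = Dead⇒inert D d

data Padded : π.Term 0 → π.Term 0 → Set where
  pad-refl : ∀ {W} → Padded W W
  pad-parL : ∀ {W W' G} → Padded W W' → Dead G → Padded W (π.par W' G)
  pad-parR : ∀ {W W' G} → Padded W W' → Dead G → Padded W (π.par G W')

Padded-trans : ∀ {A B C} → Padded A B → Padded B C → Padded A C
Padded-trans p pad-refl       = p
Padded-trans p (pad-parL q D) = pad-parL (Padded-trans p q) D
Padded-trans p (pad-parR q D) = pad-parR (Padded-trans p q) D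

guarded-Dead : ∀ b (φ : Fm 0) {Z} → Dead Z → Dead (guarded b φ Z)
guarded-Dead true  (eqF p q)  D = dead-under D
guarded-Dead false (eqF p q)  D = dead-under D
guarded-Dead b     (notF φ)   D = guarded-Dead (not b) φ D
guarded-Dead true  (andF φ ψ) D = guarded-Dead true φ (guarded-Dead true ψ D)
guarded-Dead false (andF φ ψ) D =
  dead-par (guarded-Dead false φ (dead-par (guarded-Dead true ψ D) (guarded-Dead false ψ D)))
           (guarded-Dead true φ (guarded-Dead false ψ D))

guarded-refuted : ∀ b (φ : Fm 0) Z → evalFm φ ≡ just b → Dead (guarded (not b) φ Z)
guarded-refuted true  (eqF (nm a) (nm a')) Z e = dead-cnd (cong nm (≡ᵇ⇒≡′ (just-injective e)))
guarded-refuted false (eqF (nm a) (nm a')) Z e = dead-cnd λ { refl → ≡ᵇ⇒≢ {a} (just-injective e) refl }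
guarded-refuted b (notF φ) Z e = guarded-refuted (not b) φ Z (evalFm-notF⁻¹ φ e)
guarded-refuted true (andF φ ψ) Z e with evalFm-andF⁻¹ φ ψ e
... | true , true , e₁ , e₂ , _ =
  dead-par (guarded-refuted true φ _ e₁) (guarded-Dead true φ (guarded-refuted true ψ Z e₂))
guarded-refuted false (andF φ ψ) Z e with evalFm-andF⁻¹ φ ψ e
... | true  , false , e₁ , e₂ , _ = guarded-Dead true φ (guarded-refuted false ψ Z e₂)
... | false , v     , e₁ , e₂ , _ = guarded-refuted false φ _ e₁

BoundOK-mono : ∀ α {A B : π.Term 0} → (∀ {c} → π.Occ (isNm c) B → π.Occ (isNm c) A) →
               π.BoundOK α A → π.BoundOK α B
BoundOK-mono (lab (inL a b))   h ok = tt
BoundOK-mono (lab (outL a b))  h ok = tt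
BoundOK-mono (lab (boutL a c)) h ok = ok ∘ h
BoundOK-mono τ                 h ok = tt

guarded-step : ∀ b (φ : Fm 0) {Z α W} → evalFm φ ≡ just b → Z π.⟶[ α ] W →
               π.BoundOK α (guarded b φ Z) → ∃ λ W' → guarded b φ Z π.⟶[ α ] W' × Padded W W'

guarded-either : ∀ b (ψ : Fm 0) {Z α W} → evalFm ψ ≡ just b → Z π.⟶[ α ] W →
                 π.BoundOK α (π.par (guarded true ψ Z) (guarded false ψ Z)) →
                 ∃ λ W' → π.par (guarded true ψ Z) (guarded false ψ Z) π.⟶[ α ] W' × Padded W W'

guarded-step true  (eqF (nm a) (nm a')) e d ok = _ , π.cond (≡ᵇ⇒≡′ (just-injective e)) d , pad-refl
guarded-step false (eqF (nm a) (nm a')) e d ok = _ , π.cond (≡ᵇ⇒≢ (just-injective e)) d , pad-refl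
guarded-step b (notF φ) e d ok = guarded-step (not b) φ (evalFm-notF⁻¹ φ e) d ok
guarded-step true (andF φ ψ) {α = α} e d ok with evalFm-andF⁻¹ φ ψ e
... | true , true , e₁ , e₂ , _ =
  let _ , d₁ , p₁ = guarded-step true ψ e₂ d (BoundOK-mono α (Occ-guarded-body true φ _) ok)
      _ , d₂ , p₂ = guarded-step true φ e₁ d₁ ok
  in _ , d₂ , Padded-trans p₁ p₂
guarded-step false (andF φ ψ) {α = α} e d ok with evalFm-andF⁻¹ φ ψ e
... | true , false , e₁ , e₂ , _ =
  let _ , d₁ , p₁ = guarded-step false ψ e₂ d (BoundOK-mono α (inj₂ ∘ Occ-guarded-body true φ _) ok)
      _ , d₂ , p₂ = guarded-step true φ e₁ d₁ (BoundOK-mono α inj₂ ok)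
  in _ , π.parR d₂ (BoundOK-mono α inj₁ ok) ,
     pad-parR (Padded-trans p₁ p₂) (guarded-refuted true φ _ e₁)
... | false , v , e₁ , e₂ , _ =
  let _ , d₁ , p₁ = guarded-either v ψ e₂ d (BoundOK-mono α (inj₁ ∘ Occ-guarded-body false φ _) ok)
      _ , d₂ , p₂ = guarded-step false φ e₁ d₁ (BoundOK-mono α inj₁ ok)
  in _ , π.parL d₂ (BoundOK-mono α inj₂ ok) ,
     pad-parL (Padded-trans p₁ p₂) (guarded-refuted false φ _ e₁)

guarded-either true ψ {Z} {α} e d ok =
  let _ , d' , p = guarded-step true ψ e d (BoundOK-mono α inj₁ ok)
  in _ , π.parL d' (BoundOK-mono α inj₂ ok) , pad-parL p (guarded-refuted true ψ Z e)
guarded-either false ψ {Z} {α} e d ok =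
  let _ , d' , p = guarded-step false ψ e d (BoundOK-mono α inj₂ ok)
  in _ , π.parR d' (BoundOK-mono α inj₁ ok) , pad-parR p (guarded-refuted false ψ Z e)

height : ∀ {S α S'} → S π.⟶[ α ] S' → ℕ
height (π.inp i c)      = 1
height (π.out i e)      = 1
height (π.parL d _)     = suc (height d)
height (π.parR d _)     = suc (height d)
height (π.comL d e)     = suc (height d ⊔ height e)
height (π.comR d e)     = suc (height d ⊔ height e)
height (π.closL d e _)  = suc (height d ⊔ height e)
height (π.closR d e _)  = suc (height d ⊔ height e)
height (π.opn _ _ d)    = suc (height d)
height (π.resS _ d _)   = suc (height d)
height (π.cond _ d)     = suc (height d)
height π.repO           = 1
height (π.repI b)       = 1

guarded-step⁻¹ : ∀ b (φ : Fm 0) {Z α W'} (D : guarded b φ Z π.⟶[ α ] W') →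
                 evalFm φ ≡ just b ×
                 ∃ λ W → Σ (Z π.⟶[ α ] W) λ D' → Padded W W' × height D' < height D

guarded-either⁻¹ : ∀ (ψ : Fm 0) {Z α W'} (D : π.par (guarded true ψ Z) (guarded false ψ Z) π.⟶[ α ] W') →
                   ∃ λ b → evalFm ψ ≡ just b ×
                   ∃ λ W → Σ (Z π.⟶[ α ] W) λ D' → Padded W W' × height D' < height D

guarded-exclusive : ∀ (φ : Fm 0) {Z Z' α β W W'} →
                    guarded true φ Z π.⟶[ α ] W → ¬ (guarded false φ Z' π.⟶[ β ] W')

guarded-step⁻¹ true (eqF (nm a) (nm a')) (π.cond refl D) =
  cong just (dec-true (a ≟ a) refl) , _ , D , pad-refl , n<1+n _
guarded-step⁻¹ false (eqF (nm a) (nm a')) (π.cond a≢a' D) =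
  cong just (dec-false (a ≟ a') a≢a') , _ , D , pad-refl , n<1+n _
guarded-step⁻¹ b (notF φ) D with guarded-step⁻¹ (not b) φ D
... | e , rest = evalFm-notF φ e , rest
guarded-step⁻¹ true (andF φ ψ) D with guarded-step⁻¹ true φ D
... | e₁ , _ , D₁ , p₁ , lt₁ with guarded-step⁻¹ true ψ D₁
...   | e₂ , _ , D₂ , p₂ , lt₂ = evalFm-andF φ ψ e₁ e₂ , _ , D₂ , Padded-trans p₂ p₁ , <-trans lt₂ lt₁
guarded-step⁻¹ false (andF φ ψ) (π.parL D _) with guarded-step⁻¹ false φ D
... | e₁ , _ , D₁ , p₁ , lt₁ with guarded-either⁻¹ ψ D₁
...   | _ , e₂ , _ , D₂ , p₂ , lt₂ =
  evalFm-andF φ ψ e₁ e₂ , _ , D₂ , pad-parL (Padded-trans p₂ p₁) (guarded-refuted false φ _ e₁) ,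
  <-trans lt₂ (<-trans lt₁ (n<1+n _))
guarded-step⁻¹ false (andF φ ψ) (π.parR D _) with guarded-step⁻¹ true φ D
... | e₁ , _ , D₁ , p₁ , lt₁ with guarded-step⁻¹ false ψ D₁
...   | e₂ , _ , D₂ , p₂ , lt₂ =
  evalFm-andF φ ψ e₁ e₂ , _ , D₂ , pad-parR (Padded-trans p₂ p₁) (guarded-refuted true φ _ e₁) ,
  <-trans lt₂ (<-trans lt₁ (n<1+n _))
guarded-step⁻¹ false (andF φ ψ) (π.comL D E)    = ⊥-elim (guarded-exclusive φ E D)
guarded-step⁻¹ false (andF φ ψ) (π.comR D E)    = ⊥-elim (guarded-exclusive φ E D)
guarded-step⁻¹ false (andF φ ψ) (π.closL D E _) = ⊥-elim (guarded-exclusive φ E D)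
guarded-step⁻¹ false (andF φ ψ) (π.closR D E _) = ⊥-elim (guarded-exclusive φ E D)

guarded-either⁻¹ ψ {Z} (π.parL D _) with guarded-step⁻¹ true ψ D
... | e , _ , D' , p , lt =
  true , e , _ , D' , pad-parL p (guarded-refuted true ψ Z e) , <-trans lt (n<1+n _)
guarded-either⁻¹ ψ {Z} (π.parR D _) with guarded-step⁻¹ false ψ D
... | e , _ , D' , p , lt =
  false , e , _ , D' , pad-parR p (guarded-refuted false ψ Z e) , <-trans lt (n<1+n _)
guarded-either⁻¹ ψ (π.comL D E)    = ⊥-elim (guarded-exclusive ψ D E)
guarded-either⁻¹ ψ (π.comR D E)    = ⊥-elim (guarded-exclusive ψ D E)
guarded-either⁻¹ ψ (π.closL D E _) = ⊥-elim (guarded-exclusive ψ D E)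
guarded-either⁻¹ ψ (π.closR D E _) = ⊥-elim (guarded-exclusive ψ D E)

guarded-exclusive φ D E =
  just-true≢just-false (proj₁ (guarded-step⁻¹ true φ D)) (proj₁ (guarded-step⁻¹ false φ E))

supAt : ∀ {n} → At n → ℕ
supAt (nm a)  = a
supAt (var x) = 0
supAt (bv i)  = 0

supMM : ∀ {n} → MM n → ℕ
supMM (eqC p q)  = supAt p ⊔ supAt q
supMM (neqC p q) = supAt p ⊔ supAt q

supFin : ∀ k → (Fin (suc k) → ℕ) → ℕ
supFin zero    f = f zero
supFin (suc k) f = f zero ⊔ supFin k (f ∘ suc)

supNames : ∀ {n} → π.Term n → ℕ
supNames π.nil              = 0
supNames (π.inpSum p k f)   = supAt p ⊔ supFin k (supNames ∘ f)
supNames (π.outSum p k o f) = supAt p ⊔ supFin k (λ i → supAt (o i) ⊔ supNames (f i))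
supNames (π.par S T)        = supNames S ⊔ supNames T
supNames (π.res B)          = supNames B
supNames (π.cnd l T)        = supMM l ⊔ supNames T
supNames (π.repIn p B)      = supAt p ⊔ supNames B
supNames (π.repOut p q T)   = supAt p ⊔ (supAt q ⊔ supNames T)

≤supFin : ∀ k f (i : Fin (suc k)) → f i ≤ supFin k f
≤supFin zero    f zero    = ≤-refl
≤supFin (suc k) f zero    = m≤m⊔n _ _
≤supFin (suc k) f (suc i) = ≤-trans (≤supFin k (f ∘ suc) i) (m≤n⊔m _ _)

isNm⇒≤supAt : ∀ {n c} (p : At n) → isNm c p → c ≤ supAt p
isNm⇒≤supAt (nm a) refl = ≤-refl

Occ⇒≤supNames : ∀ {n c} (T : π.Term n) → π.Occ (isNm c) T → c ≤ supNames T
Occ⇒≤supNames (π.inpSum p k f) (inj₁ x) = m≤n⇒m≤n⊔o _ (isNm⇒≤supAt p x)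
Occ⇒≤supNames (π.inpSum p k f) (inj₂ (i , x)) =
  m≤n⇒m≤o⊔n _ (≤-trans (Occ⇒≤supNames (f i) x) (≤supFin k (supNames ∘ f) i))
Occ⇒≤supNames (π.outSum p k o f) (inj₁ x) = m≤n⇒m≤n⊔o _ (isNm⇒≤supAt p x)
Occ⇒≤supNames {c = c} (π.outSum p k o f) (inj₂ (i , x)) =
  m≤n⇒m≤o⊔n _ (≤-trans (occ x) (≤supFin k (λ j → supAt (o j) ⊔ supNames (f j)) i))
  where
  occ : isNm c (o i) ⊎ π.Occ (isNm c) (f i) → c ≤ supAt (o i) ⊔ supNames (f i)
  occ (inj₁ y) = m≤n⇒m≤n⊔o _ (isNm⇒≤supAt (o i) y)
  occ (inj₂ y) = m≤n⇒m≤o⊔n _ (Occ⇒≤supNames (f i) y)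
Occ⇒≤supNames (π.par S T) (inj₁ x) = m≤n⇒m≤n⊔o _ (Occ⇒≤supNames S x)
Occ⇒≤supNames (π.par S T) (inj₂ x) = m≤n⇒m≤o⊔n _ (Occ⇒≤supNames T x)
Occ⇒≤supNames (π.res B) x = Occ⇒≤supNames B x
Occ⇒≤supNames (π.cnd (eqC p q) T) (inj₁ (inj₁ x)) =
  m≤n⇒m≤n⊔o _ (m≤n⇒m≤n⊔o _ (isNm⇒≤supAt p x))
Occ⇒≤supNames (π.cnd (eqC p q) T) (inj₁ (inj₂ x)) =
  m≤n⇒m≤n⊔o _ (m≤n⇒m≤o⊔n (supAt p) (isNm⇒≤supAt q x))
Occ⇒≤supNames (π.cnd (neqC p q) T) (inj₁ (inj₁ x)) =
  m≤n⇒m≤n⊔o _ (m≤n⇒m≤n⊔o _ (isNm⇒≤supAt p x))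
Occ⇒≤supNames (π.cnd (neqC p q) T) (inj₁ (inj₂ x)) =
  m≤n⇒m≤n⊔o _ (m≤n⇒m≤o⊔n (supAt p) (isNm⇒≤supAt q x))
Occ⇒≤supNames (π.cnd l T) (inj₂ x) = m≤n⇒m≤o⊔n (supMM l) (Occ⇒≤supNames T x)
Occ⇒≤supNames (π.repIn p B) (inj₁ x) = m≤n⇒m≤n⊔o _ (isNm⇒≤supAt p x)
Occ⇒≤supNames (π.repIn p B) (inj₂ x) = m≤n⇒m≤o⊔n _ (Occ⇒≤supNames B x)
Occ⇒≤supNames (π.repOut p q T) (inj₁ x) = m≤n⇒m≤n⊔o _ (isNm⇒≤supAt p x)
Occ⇒≤supNames (π.repOut p q T) (inj₂ (inj₁ x)) =
  m≤n⇒m≤o⊔n (supAt p) (m≤n⇒m≤n⊔o _ (isNm⇒≤supAt q x))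
Occ⇒≤supNames (π.repOut p q T) (inj₂ (inj₂ x)) =
  m≤n⇒m≤o⊔n (supAt p) (m≤n⇒m≤o⊔n (supAt q) (Occ⇒≤supNames T x))

fresh : ∀ {n} (T : π.Term n) (m : ℕ) → ∃ λ c → π.Fresh c T × m < c
fresh T m =
  suc (supNames T ⊔ m) ,
  (λ x → <⇒≢ (s≤s (≤-trans (Occ⇒≤supNames T x) (m≤m⊔n _ m))) refl) ,
  s≤s (m≤n⊔m _ m)

-- The correspondence between πᵛ and π terms

NameRel : Set₁
NameRel = ℕ → ℕ → Set

record PartialBij (R : NameRel) : Set where
  field
    functional : ∀ {a b b'} → R a b → R a b' → b ≡ b'
    injective  : ∀ {a a' b} → R a b → R a' b → a ≡ a'
open PartialBij

update : NameRel → ℕ → ℕ → NameRel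
update R c c' x y = (x ≡ c × y ≡ c') ⊎ (x ≢ c × y ≢ c' × R x y)

PartialBij-update : ∀ {R} c c' → PartialBij R → PartialBij (update R c c')
PartialBij-update c c' bij .functional (inj₁ (refl , refl)) (inj₁ (_ , refl))     = refl
PartialBij-update c c' bij .functional (inj₁ (refl , _))    (inj₂ (c≢c , _))      = ⊥-elim (c≢c refl)
PartialBij-update c c' bij .functional (inj₂ (c≢c , _))     (inj₁ (refl , _))     = ⊥-elim (c≢c refl)
PartialBij-update c c' bij .functional (inj₂ (_ , _ , r))   (inj₂ (_ , _ , r'))   = functional bij r r'
PartialBij-update c c' bij .injective  (inj₁ (refl , refl)) (inj₁ (refl , _))     = refl
PartialBij-update c c' bij .injective  (inj₁ (_ , refl))    (inj₂ (_ , c'≢c' , _)) = ⊥-elim (c'≢c' refl)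
PartialBij-update c c' bij .injective  (inj₂ (_ , c'≢c' , _)) (inj₁ (_ , refl))   = ⊥-elim (c'≢c' refl)
PartialBij-update c c' bij .injective  (inj₂ (_ , _ , r))   (inj₂ (_ , _ , r'))   = injective bij r r'

PartialBij-≡ : PartialBij _≡_
PartialBij-≡ .functional refl refl = refl
PartialBij-≡ .injective  refl refl = refl

AtRel : NameRel → ∀ {n} → At n → At n → Set
AtRel R (nm a)  (nm b)  = R a b
AtRel R (var x) (var y) = x ≡ y
AtRel R (bv i)  (bv j)  = i ≡ j
AtRel R _       _       = ⊥

data FmRel (R : NameRel) {n} : Fm n → Fm n → Set where
  eqR  : ∀ {p q p' q'} → AtRel R p p' → AtRel R q q' → FmRel R (eqF p q) (eqF p' q')
  andR : ∀ {φ ψ φ' ψ'} → FmRel R φ φ' → FmRel R ψ ψ' → FmRel R (andF φ ψ) (andF φ' ψ')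
  notR : ∀ {φ φ'} → FmRel R φ φ' → FmRel R (notF φ) (notF φ')

-- Corr R top X Y: Y is the π encoding of X up to the renaming R of free names.  Outside all
-- prefixes (top = true) Y may also carry Dead parallel components: what remains of a negated
-- conjunction once a transition has decided its condition.  R is a partial bijection rather
-- than equality because a name fresh for X need not be fresh for that padding.
data Corr (R : NameRel) : Bool → ∀ {n} → πᵛ.Term n → π.Term n → Set where
  rNil    : ∀ {top n} → Corr R top {n} πᵛ.nil π.nil
  rInp    : ∀ {top n p q k f h} → AtRel R {n} p q → (∀ i → Corr R false (f i) (h i)) →
            Corr R top (πᵛ.inpSum p k f) (π.inpSum q k h)
  rOut    : ∀ {top n p q k o o' f h} → AtRel R {n} p q → (∀ i → AtRel R (o i) (o' i)) →
            (∀ i → Corr R false (f i) (h i)) → Corr R top (πᵛ.outSum p k o f) (π.outSum q k o' h)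
  rPar    : ∀ {top n S S' T T'} → Corr R top {n} S S' → Corr R top T T' →
            Corr R top (πᵛ.par S T) (π.par S' T')
  rRes    : ∀ {top n B B'} → Corr R top {suc n} B B' → Corr R top (πᵛ.res B) (π.res B')
  rCnd    : ∀ {top n φ φ' T T'} → FmRel R {n} φ φ' → Corr R false T T' →
            Corr R top (πᵛ.cnd φ T) (guarded true φ' T')
  rRepIn  : ∀ {top n p q B B'} → AtRel R {n} p q → Corr R false B B' →
            Corr R top (πᵛ.repIn p B) (π.repIn q B')
  rRepOut : ∀ {top n p q p' q' T T'} → AtRel R {n} p q → AtRel R p' q' → Corr R false T T' →
            Corr R top (πᵛ.repOut p p' T) (π.repOut q q' T')
  rPadL   : ∀ {n X Y G} → Corr R true {n} X Y → Dead G → Corr R true X (π.par Y G)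
  rPadR   : ∀ {n X Y G} → Corr R true {n} X Y → Dead G → Corr R true X (π.par G Y)

Corr-top : ∀ {R top n X Y} → Corr R top {n} X Y → Corr R true X Y
Corr-top rNil            = rNil
Corr-top (rInp a r)      = rInp a r
Corr-top (rOut a o r)    = rOut a o r
Corr-top (rPar r s)      = rPar (Corr-top r) (Corr-top s)
Corr-top (rRes r)        = rRes (Corr-top r)
Corr-top (rCnd f r)      = rCnd f r
Corr-top (rRepIn a r)    = rRepIn a r
Corr-top (rRepOut a b r) = rRepOut a b r
Corr-top (rPadL r D)     = rPadL r D
Corr-top (rPadR r D)     = rPadR r D

module _ {R R' : NameRel} (R⇒R' : ∀ {a b} → R a b → R' a b) where

  AtRel-map : ∀ {n} (p q : At n) → AtRel R p q → AtRel R' p q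
  AtRel-map (nm a)  (nm b)  r = R⇒R' r
  AtRel-map (var x) (var y) r = r
  AtRel-map (bv i)  (bv j)  r = r

  FmRel-map : ∀ {n} {φ φ' : Fm n} → FmRel R φ φ' → FmRel R' φ φ'
  FmRel-map (eqR {p} {q} {p'} {q'} a b) = eqR (AtRel-map p p' a) (AtRel-map q q' b)
  FmRel-map (andR f g) = andR (FmRel-map f) (FmRel-map g)
  FmRel-map (notR f)   = notR (FmRel-map f)

  Corr-map : ∀ {top n X Y} → Corr R top {n} X Y → Corr R' top X Y
  Corr-map rNil = rNil
  Corr-map (rInp {p = p} {q} a r) = rInp (AtRel-map p q a) (Corr-map ∘ r)
  Corr-map (rOut {p = p} {q} {o = o} {o'} a os r) =
    rOut (AtRel-map p q a) (λ i → AtRel-map (o i) (o' i) (os i)) (Corr-map ∘ r)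
  Corr-map (rPar r s)   = rPar (Corr-map r) (Corr-map s)
  Corr-map (rRes r)     = rRes (Corr-map r)
  Corr-map (rCnd f r)   = rCnd (FmRel-map f) (Corr-map r)
  Corr-map (rRepIn {p = p} {q} a r) = rRepIn (AtRel-map p q a) (Corr-map r)
  Corr-map (rRepOut {p = p} {q} {p'} {q'} a b r) =
    rRepOut (AtRel-map p q a) (AtRel-map p' q' b) (Corr-map r)
  Corr-map (rPadL r D) = rPadL (Corr-map r) D
  Corr-map (rPadR r D) = rPadR (Corr-map r) D

module _ {R R' : NameRel} c c' (restrict : ∀ {a b} → R a b → a ≢ c → b ≢ c' → R' a b) where

  AtRel-restrict : ∀ {n} (p q : At n) → AtRel R p q → ¬ isNm c p → ¬ isNm c' q → AtRel R' p q
  AtRel-restrict (nm a)  (nm b)  r a≢c b≢c' = restrict r a≢c b≢c'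
  AtRel-restrict (var x) (var y) r _   _    = r
  AtRel-restrict (bv i)  (bv j)  r _   _    = r

  FmRel-restrict : ∀ {n} {φ φ' : Fm n} → FmRel R φ φ' →
                   ¬ occFm (isNm c) φ → ¬ occFm (isNm c') φ' → FmRel R' φ φ'
  FmRel-restrict (eqR {p} {q} {p'} {q'} a b) f₁ f₂ =
    eqR (AtRel-restrict p p' a (f₁ ∘ inj₁) (f₂ ∘ inj₁)) (AtRel-restrict q q' b (f₁ ∘ inj₂) (f₂ ∘ inj₂))
  FmRel-restrict (andR f g) f₁ f₂ =
    andR (FmRel-restrict f (f₁ ∘ inj₁) (f₂ ∘ inj₁)) (FmRel-restrict g (f₁ ∘ inj₂) (f₂ ∘ inj₂))
  FmRel-restrict (notR f) f₁ f₂ = notR (FmRel-restrict f f₁ f₂)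

  Corr-restrict : ∀ {top n X Y} → Corr R top {n} X Y → πᵛ.Fresh c X → π.Fresh c' Y → Corr R' top X Y
  Corr-restrict rNil f₁ f₂ = rNil
  Corr-restrict (rInp {p = p} {q} a r) f₁ f₂ =
    rInp (AtRel-restrict p q a (f₁ ∘ inj₁) (f₂ ∘ inj₁))
         (λ i → Corr-restrict (r i) (f₁ ∘ inj₂ ∘ (i ,_)) (f₂ ∘ inj₂ ∘ (i ,_)))
  Corr-restrict (rOut {p = p} {q} {o = o} {o'} a os r) f₁ f₂ =
    rOut (AtRel-restrict p q a (f₁ ∘ inj₁) (f₂ ∘ inj₁))
         (λ i → AtRel-restrict (o i) (o' i) (os i)
                               (f₁ ∘ inj₂ ∘ (i ,_) ∘ inj₁) (f₂ ∘ inj₂ ∘ (i ,_) ∘ inj₁))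
         (λ i → Corr-restrict (r i) (f₁ ∘ inj₂ ∘ (i ,_) ∘ inj₂) (f₂ ∘ inj₂ ∘ (i ,_) ∘ inj₂))
  Corr-restrict (rPar r s) f₁ f₂ =
    rPar (Corr-restrict r (f₁ ∘ inj₁) (f₂ ∘ inj₁)) (Corr-restrict s (f₁ ∘ inj₂) (f₂ ∘ inj₂))
  Corr-restrict (rRes r) f₁ f₂ = rRes (Corr-restrict r f₁ f₂)
  Corr-restrict (rCnd {φ' = φ'} {T' = T'} f r) f₁ f₂ =
    rCnd (FmRel-restrict f (f₁ ∘ inj₁) (f₂ ∘ Occ-guarded-cond true φ' T'))
         (Corr-restrict r (f₁ ∘ inj₂) (f₂ ∘ Occ-guarded-body true φ' T'))
  Corr-restrict (rRepIn {p = p} {q} a r) f₁ f₂ =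
    rRepIn (AtRel-restrict p q a (f₁ ∘ inj₁) (f₂ ∘ inj₁)) (Corr-restrict r (f₁ ∘ inj₂) (f₂ ∘ inj₂))
  Corr-restrict (rRepOut {p = p} {q} {p'} {q'} a b r) f₁ f₂ =
    rRepOut (AtRel-restrict p q a (f₁ ∘ inj₁) (f₂ ∘ inj₁))
            (AtRel-restrict p' q' b (f₁ ∘ inj₂ ∘ inj₁) (f₂ ∘ inj₂ ∘ inj₁))
            (Corr-restrict r (f₁ ∘ inj₂ ∘ inj₂) (f₂ ∘ inj₂ ∘ inj₂))
  Corr-restrict (rPadL r D) f₁ f₂ = rPadL (Corr-restrict r f₁ (f₂ ∘ inj₁)) D
  Corr-restrict (rPadR r D) f₁ f₂ = rPadR (Corr-restrict r f₁ (f₂ ∘ inj₂)) D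

data ExtView {n} : At (suc n) → Set where
  vz : ExtView (bv zero)
  vs : (x : At n) → ExtView (wkA x)

extView : ∀ {n} (p : At (suc n)) → ExtView p
extView (bv zero)    = vz
extView (bv (suc i)) = vs (bv i)
extView (nm a)       = vs (nm a)
extView (var x)      = vs (var x)

extA-wkA : ∀ {n m} (σ : At n → At m) (x : At n) → extA σ (wkA x) ≡ wkA (σ x)
extA-wkA σ (nm a)  = refl
extA-wkA σ (var x) = refl
extA-wkA σ (bv i)  = refl

wkA≢bv0 : ∀ {n} (x : At n) → wkA x ≢ bv zero
wkA≢bv0 (nm a)  ()
wkA≢bv0 (var x) ()
wkA≢bv0 (bv i)  ()

wkA-injective : ∀ {n} (x y : At n) → wkA x ≡ wkA y → x ≡ y
wkA-injective (nm a)  (nm .a)  refl = refl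
wkA-injective (var x) (var .x) refl = refl
wkA-injective (bv i)  (bv .i)  refl = refl

AtRel-wkA : ∀ {R n} (x y : At n) → AtRel R x y → AtRel R (wkA x) (wkA y)
AtRel-wkA (nm a)  (nm b)  r = r
AtRel-wkA (var x) (var y) r = r
AtRel-wkA (bv i)  (bv j)  r = cong suc r

AtRel-wkA⁻¹ : ∀ {R n} (x y : At n) → AtRel R (wkA x) (wkA y) → AtRel R x y
AtRel-wkA⁻¹ (nm a)  (nm b)  r    = r
AtRel-wkA⁻¹ (var x) (var y) r    = r
AtRel-wkA⁻¹ (bv i)  (bv j)  refl = refl

¬AtRel-bv0-wkA : ∀ {R n} (x : At n) → ¬ AtRel R (bv zero) (wkA x)
¬AtRel-bv0-wkA (nm a)  ()
¬AtRel-bv0-wkA (var x) ()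
¬AtRel-bv0-wkA (bv i)  ()

¬AtRel-wkA-bv0 : ∀ {R n} (x : At n) → ¬ AtRel R (wkA x) (bv zero)
¬AtRel-wkA-bv0 (nm a)  ()
¬AtRel-wkA-bv0 (var x) ()
¬AtRel-wkA-bv0 (bv i)  ()

Transports : NameRel → NameRel → AtomPred → AtomPred → ∀ {n m} → (At n → At m) → (At n → At m) → Set
Transports R R' bx by σ₁ σ₂ = ∀ p q → AtRel R p q → ¬ ⟦ bx ⟧ p → ¬ ⟦ by ⟧ q → AtRel R' (σ₁ p) (σ₂ q)

InjectiveOff : AtomPred → ∀ {n m} → (At n → At m) → Set
InjectiveOff by σ = ∀ p q → ¬ ⟦ by ⟧ p → ¬ ⟦ by ⟧ q → σ p ≡ σ q → p ≡ q

Transports-extA : ∀ {R R' bx by n m} (σ₁ σ₂ : At n → At m) →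
                  Transports R R' bx by σ₁ σ₂ → Transports R R' bx by (extA σ₁) (extA σ₂)
Transports-extA σ₁ σ₂ h p q r p∉ q∉ with extView p | extView q
... | vz   | vz   = refl
... | vz   | vs y = ⊥-elim (¬AtRel-bv0-wkA y r)
... | vs x | vz   = ⊥-elim (¬AtRel-wkA-bv0 x r)
Transports-extA {bx = bx} {by} σ₁ σ₂ h p q r p∉ q∉ | vs x | vs y
  rewrite extA-wkA σ₁ x | extA-wkA σ₂ y =
  AtRel-wkA (σ₁ x) (σ₂ y) (h x y (AtRel-wkA⁻¹ x y r) (p∉ ∘ ⟦⟧-wk bx x) (q∉ ∘ ⟦⟧-wk by y))

InjectiveOff-extA : ∀ {by n m} (σ : At n → At m) → InjectiveOff by σ → InjectiveOff by (extA σ)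
InjectiveOff-extA σ h p q p∉ q∉ e with extView p | extView q
... | vz | vz = refl
InjectiveOff-extA σ h p q p∉ q∉ e | vz   | vs y rewrite extA-wkA σ y = ⊥-elim (wkA≢bv0 (σ y) (sym e))
InjectiveOff-extA σ h p q p∉ q∉ e | vs x | vz   rewrite extA-wkA σ x = ⊥-elim (wkA≢bv0 (σ x) e)
InjectiveOff-extA {by} σ h p q p∉ q∉ e | vs x | vs y rewrite extA-wkA σ x | extA-wkA σ y =
  cong wkA (h x y (p∉ ∘ ⟦⟧-wk by x) (q∉ ∘ ⟦⟧-wk by y) (wkA-injective (σ x) (σ y) e))

Dead-sub : ∀ {by n m} (σ : At n → At m) → InjectiveOff by σ → {G : π.Term n} →
           Dead G → ¬ π.Occ ⟦ by ⟧ G → Dead (π.sub σ G)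
Dead-sub σ inj (dead-cnd {l = eqC p q} p≢q) o =
  dead-cnd (p≢q ∘ inj p q (o ∘ inj₁ ∘ inj₁) (o ∘ inj₁ ∘ inj₂))
Dead-sub σ inj (dead-cnd {l = neqC p .p} refl) o = dead-cnd refl
Dead-sub {by} σ inj (dead-under D) o = dead-under (Dead-sub {by} σ inj D (o ∘ inj₂))
Dead-sub {by} σ inj (dead-par D E) o =
  dead-par (Dead-sub {by} σ inj D (o ∘ inj₁)) (Dead-sub {by} σ inj E (o ∘ inj₂))

guarded-sub : ∀ {n m} b (φ : Fm n) (σ : At n → At m) Z →
              π.sub σ (guarded b φ Z) ≡ guarded b (mapFm σ φ) (π.sub σ Z)
guarded-sub true  (eqF p q)  σ Z = refl
guarded-sub false (eqF p q)  σ Z = refl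
guarded-sub b     (notF φ)   σ Z = guarded-sub (not b) φ σ Z
guarded-sub true  (andF φ ψ) σ Z =
  trans (guarded-sub true φ σ _) (cong (guarded true (mapFm σ φ)) (guarded-sub true ψ σ Z))
guarded-sub false (andF φ ψ) σ Z =
  cong₂ π.par
    (trans (guarded-sub false φ σ _)
           (cong (guarded false (mapFm σ φ))
                 (cong₂ π.par (guarded-sub true ψ σ Z) (guarded-sub false ψ σ Z))))
    (trans (guarded-sub true φ σ _) (cong (guarded true (mapFm σ φ)) (guarded-sub false ψ σ Z)))

module _ {R R' : NameRel} (bx by : AtomPred) where

  FmRel-sub : ∀ {n m} (σ₁ σ₂ : At n → At m) → Transports R R' bx by σ₁ σ₂ → {φ φ' : Fm n} →
              FmRel R φ φ' → ¬ occFm ⟦ bx ⟧ φ → ¬ occFm ⟦ by ⟧ φ' → FmRel R' (mapFm σ₁ φ) (mapFm σ₂ φ')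
  FmRel-sub σ₁ σ₂ h (eqR {p} {q} {p'} {q'} a b) f₁ f₂ =
    eqR (h p p' a (f₁ ∘ inj₁) (f₂ ∘ inj₁)) (h q q' b (f₁ ∘ inj₂) (f₂ ∘ inj₂))
  FmRel-sub σ₁ σ₂ h (andR f g) f₁ f₂ =
    andR (FmRel-sub σ₁ σ₂ h f (f₁ ∘ inj₁) (f₂ ∘ inj₁)) (FmRel-sub σ₁ σ₂ h g (f₁ ∘ inj₂) (f₂ ∘ inj₂))
  FmRel-sub σ₁ σ₂ h (notR f) f₁ f₂ = notR (FmRel-sub σ₁ σ₂ h f f₁ f₂)

  -- Injectivity is needed only at top level, to keep the padding Dead.
  Corr-sub : ∀ {top n m X Y} (σ₁ σ₂ : At n → At m) → Transports R R' bx by σ₁ σ₂ →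
             (top ≡ true → InjectiveOff by σ₂) → Corr R top X Y →
             ¬ πᵛ.Occ ⟦ bx ⟧ X → ¬ π.Occ ⟦ by ⟧ Y → Corr R' top (πᵛ.sub σ₁ X) (π.sub σ₂ Y)
  Corr-sub σ₁ σ₂ h inj rNil f₁ f₂ = rNil
  Corr-sub σ₁ σ₂ h inj (rInp {p = p} {q} a r) f₁ f₂ =
    rInp (h p q a (f₁ ∘ inj₁) (f₂ ∘ inj₁))
         (λ i → Corr-sub (extA σ₁) (extA σ₂) (Transports-extA {bx = bx} {by} σ₁ σ₂ h) (λ ()) (r i)
                         (f₁ ∘ inj₂ ∘ (i ,_)) (f₂ ∘ inj₂ ∘ (i ,_)))
  Corr-sub σ₁ σ₂ h inj (rOut {p = p} {q} {o = o} {o'} a os r) f₁ f₂ =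
    rOut (h p q a (f₁ ∘ inj₁) (f₂ ∘ inj₁))
         (λ i → h (o i) (o' i) (os i) (f₁ ∘ inj₂ ∘ (i ,_) ∘ inj₁) (f₂ ∘ inj₂ ∘ (i ,_) ∘ inj₁))
         (λ i → Corr-sub σ₁ σ₂ h (λ ()) (r i) (f₁ ∘ inj₂ ∘ (i ,_) ∘ inj₂) (f₂ ∘ inj₂ ∘ (i ,_) ∘ inj₂))
  Corr-sub σ₁ σ₂ h inj (rPar r s) f₁ f₂ =
    rPar (Corr-sub σ₁ σ₂ h inj r (f₁ ∘ inj₁) (f₂ ∘ inj₁))
         (Corr-sub σ₁ σ₂ h inj s (f₁ ∘ inj₂) (f₂ ∘ inj₂))
  Corr-sub σ₁ σ₂ h inj (rRes r) f₁ f₂ =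
    rRes (Corr-sub (extA σ₁) (extA σ₂) (Transports-extA {bx = bx} {by} σ₁ σ₂ h)
                   (InjectiveOff-extA {by} σ₂ ∘ inj) r f₁ f₂)
  Corr-sub {top} σ₁ σ₂ h inj (rCnd {φ' = φ'} {T' = T'} f r) f₁ f₂ =
    subst (Corr R' top _) (sym (guarded-sub true φ' σ₂ T'))
      (rCnd (FmRel-sub σ₁ σ₂ h f (f₁ ∘ inj₁) (f₂ ∘ Occ-guarded-cond true φ' T'))
            (Corr-sub σ₁ σ₂ h (λ ()) r (f₁ ∘ inj₂) (f₂ ∘ Occ-guarded-body true φ' T')))
  Corr-sub σ₁ σ₂ h inj (rRepIn {p = p} {q} a r) f₁ f₂ =
    rRepIn (h p q a (f₁ ∘ inj₁) (f₂ ∘ inj₁))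
           (Corr-sub (extA σ₁) (extA σ₂) (Transports-extA {bx = bx} {by} σ₁ σ₂ h) (λ ()) r
                     (f₁ ∘ inj₂) (f₂ ∘ inj₂))
  Corr-sub σ₁ σ₂ h inj (rRepOut {p = p} {q} {p'} {q'} a b r) f₁ f₂ =
    rRepOut (h p q a (f₁ ∘ inj₁) (f₂ ∘ inj₁))
            (h p' q' b (f₁ ∘ inj₂ ∘ inj₁) (f₂ ∘ inj₂ ∘ inj₁))
            (Corr-sub σ₁ σ₂ h (λ ()) r (f₁ ∘ inj₂ ∘ inj₂) (f₂ ∘ inj₂ ∘ inj₂))
  Corr-sub σ₁ σ₂ h inj (rPadL r D) f₁ f₂ =
    rPadL (Corr-sub σ₁ σ₂ h inj r f₁ (f₂ ∘ inj₁)) (Dead-sub {by} σ₂ (inj refl) D (f₂ ∘ inj₂))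
  Corr-sub σ₁ σ₂ h inj (rPadR r D) f₁ f₂ =
    rPadR (Corr-sub σ₁ σ₂ h inj r f₁ (f₂ ∘ inj₂)) (Dead-sub {by} σ₂ (inj refl) D (f₂ ∘ inj₁))

instA-absA : ∀ c (p : At 0) → instA c (absA c p) ≡ p
instA-absA c (nm a) with a ≟ c
... | yes refl rewrite absA-≡ a   = refl
... | no  a≢c  rewrite absA-≢ a≢c = refl
instA-absA c (var x) = refl

absA-injective : ∀ c → InjectiveOff noneᵖ (absA c)
absA-injective c p q _ _ e = trans (sym (instA-absA c p)) (trans (cong (instA c) e) (instA-absA c q))

absA-transports : ∀ {R} c c' → Transports (update R c c') R noneᵖ noneᵖ (absA c) (absA c')
absA-transports c c' (nm x) (nm y) (inj₁ (refl , refl))   _ _ rewrite absA-≡ x | absA-≡ y = refl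
absA-transports c c' (nm x) (nm y) (inj₂ (x≢c , y≢c' , r)) _ _ rewrite absA-≢ x≢c | absA-≢ y≢c' = r
absA-transports c c' (var x) (var y) r _ _ = r

Corr-closeT : ∀ {R top X Y} c c' → Corr (update R c c') top X Y →
              Corr R top (πᵛ.closeT c X) (π.closeT c' Y)
Corr-closeT {X = X} {Y} c c' r =
  Corr-sub noneᵖ noneᵖ (absA c) (absA c') (absA-transports c c') (λ _ → absA-injective c') r
           (Occπᵛ.¬Occ-none X) (Occπ.¬Occ-none Y)

instA-transports-fresh : ∀ {R} c c' →
                         Transports R (update R c c') (isNmᵖ c) (isNmᵖ c') (instA c) (instA c')
instA-transports-fresh c c' (bv zero) (bv zero) refl _   _   = inj₁ (refl , refl)
instA-transports-fresh c c' (nm x)    (nm y)    r    x≢c y≢c' = inj₂ (x≢c , y≢c' , r)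
instA-transports-fresh c c' (var x)   (var y)   r    _   _   = r

instA-injective : ∀ c → InjectiveOff (isNmᵖ c) (instA c)
instA-injective c (bv zero) (bv zero) _   _   _    = refl
instA-injective c (bv zero) (nm y)    _   y≢c refl = ⊥-elim (y≢c refl)
instA-injective c (nm x)    (bv zero) x≢c _   refl = ⊥-elim (x≢c refl)
instA-injective c (nm x)    (nm y)    _   _   refl = refl
instA-injective c (var x)   (var y)   _   _   refl = refl
instA-injective c (bv zero) (var y)   _   _   ()
instA-injective c (var x)   (bv zero) _   _   ()
instA-injective c (nm x)    (var y)   _   _   ()
instA-injective c (var x)   (nm y)    _   _   ()

Corr-openT : ∀ {R top B B'} c c' → Corr R top B B' → πᵛ.Fresh c B → π.Fresh c' B' →
             Corr (update R c c') top (πᵛ.openT c B) (π.openT c' B')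
Corr-openT c c' =
  Corr-sub (isNmᵖ c) (isNmᵖ c') (instA c) (instA c') (instA-transports-fresh c c')
           (λ _ → instA-injective c')

instA-transports : ∀ {R b b'} → R b b' → Transports R R noneᵖ noneᵖ (instA b) (instA b')
instA-transports rb (bv zero) (bv zero) refl _ _ = rb
instA-transports rb (nm x)    (nm y)    r    _ _ = r
instA-transports rb (var x)   (var y)   r    _ _ = r

-- Under a prefix there is no padding, so no injectivity is needed and any names may be substituted.
Corr-instantiate : ∀ {R B B' b b'} → R b b' → Corr R false B B' →
                   Corr R true (πᵛ.openT b B) (π.openT b' B')
Corr-instantiate {B = B} {B'} {b} {b'} rb r =
  Corr-top (Corr-sub noneᵖ noneᵖ (instA b) (instA b') (instA-transports rb) (λ ()) r
                     (Occπᵛ.¬Occ-none B) (Occπ.¬Occ-none B'))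

evalFm-FmRel : ∀ {R} → PartialBij R → {φ φ' : Fm 0} → FmRel R φ φ' → evalFm φ ≡ evalFm φ'
evalFm-FmRel bij (eqR {nm a} {nm b} {nm a'} {nm b'} ra rb) with a ≟ b
... | yes refl rewrite functional bij ra rb =
  cong just (trans (dec-true (a ≟ a) refl) (sym (dec-true (b' ≟ b') refl)))
... | no a≢b =
  cong just (trans (dec-false (a ≟ b) a≢b)
                   (sym (dec-false (a' ≟ b') λ { refl → a≢b (injective bij ra rb) })))
evalFm-FmRel bij (eqR {nm _}  {var _} {nm _}  {var _} _ _) = refl
evalFm-FmRel bij (eqR {var _} {nm _}  {var _} {nm _}  _ _) = refl
evalFm-FmRel bij (eqR {var _} {var _} {var _} {var _} _ _) = refl
evalFm-FmRel bij (eqR {nm _}  {nm _}  {nm _}  {var _} _ ())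
evalFm-FmRel bij (eqR {nm _}  {var _} {nm _}  {nm _}  _ ())
evalFm-FmRel bij (eqR {var _} {nm _}  {var _} {var _} _ ())
evalFm-FmRel bij (eqR {var _} {var _} {var _} {nm _}  _ ())
evalFm-FmRel bij (eqR {nm _}  {_}     {var _} {_}     () _)
evalFm-FmRel bij (eqR {var _} {_}     {nm _}  {_}     () _)
evalFm-FmRel bij (andR f g) rewrite evalFm-FmRel bij f | evalFm-FmRel bij g = refl
evalFm-FmRel bij (notR f)   rewrite evalFm-FmRel bij f = refl

AtRel-≡ : ∀ {n} {p q : At n} → AtRel _≡_ p q → p ≡ q
AtRel-≡ {p = nm _}  {nm _}  refl = refl
AtRel-≡ {p = var _} {var _} refl = refl
AtRel-≡ {p = bv _}  {bv _}  refl = refl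

AtRel-refl : ∀ {n} (p : At n) → AtRel _≡_ p p
AtRel-refl (nm a)  = refl
AtRel-refl (var x) = refl
AtRel-refl (bv i)  = refl

FmRel-≡ : ∀ {n} {φ φ' : Fm n} → FmRel _≡_ φ φ' → φ ≡ φ'
FmRel-≡ (eqR a b)  = cong₂ eqF (AtRel-≡ a) (AtRel-≡ b)
FmRel-≡ (andR f g) = cong₂ andF (FmRel-≡ f) (FmRel-≡ g)
FmRel-≡ (notR f)   = cong notF (FmRel-≡ f)

module _ {P : ∀ {k} → At k → Set} where

  Corr-Occ : ∀ {top n X Y} → Corr _≡_ top {n} X Y → πᵛ.Occ P X → π.Occ P Y
  Corr-Occ (rInp a r)         (inj₁ x)            = inj₁ (subst P (AtRel-≡ a) x)
  Corr-Occ (rInp a r)         (inj₂ (i , x))      = inj₂ (i , Corr-Occ (r i) x)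
  Corr-Occ (rOut a os r)      (inj₁ x)            = inj₁ (subst P (AtRel-≡ a) x)
  Corr-Occ (rOut a os r)      (inj₂ (i , inj₁ x)) = inj₂ (i , inj₁ (subst P (AtRel-≡ (os i)) x))
  Corr-Occ (rOut a os r)      (inj₂ (i , inj₂ x)) = inj₂ (i , inj₂ (Corr-Occ (r i) x))
  Corr-Occ (rPar r s)         (inj₁ x)            = inj₁ (Corr-Occ r x)
  Corr-Occ (rPar r s)         (inj₂ x)            = inj₂ (Corr-Occ s x)
  Corr-Occ (rRes r)           x                   = Corr-Occ r x
  Corr-Occ (rCnd {φ' = φ'} {T' = T'} f r) (inj₁ x) =
    Occ-guarded-cond true φ' T' (subst (occFm P) (FmRel-≡ f) x)
  Corr-Occ (rCnd {φ' = φ'} f r) (inj₂ x) = Occ-guarded-body true φ' _ (Corr-Occ r x)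
  Corr-Occ (rRepIn a r)       (inj₁ x)            = inj₁ (subst P (AtRel-≡ a) x)
  Corr-Occ (rRepIn a r)       (inj₂ x)            = inj₂ (Corr-Occ r x)
  Corr-Occ (rRepOut a b r)    (inj₁ x)            = inj₁ (subst P (AtRel-≡ a) x)
  Corr-Occ (rRepOut a b r)    (inj₂ (inj₁ x))     = inj₂ (inj₁ (subst P (AtRel-≡ b) x))
  Corr-Occ (rRepOut a b r)    (inj₂ (inj₂ x))     = inj₂ (inj₂ (Corr-Occ r x))
  Corr-Occ (rPadL r d)        x                   = inj₁ (Corr-Occ r x)
  Corr-Occ (rPadR r d)        x                   = inj₂ (Corr-Occ r x)

  Corr-Occ⁻¹ : ∀ {n X Y} → Corr _≡_ false {n} X Y → π.Occ P Y → πᵛ.Occ P X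
  Corr-Occ⁻¹ (rInp a r)         (inj₁ x)            = inj₁ (subst P (sym (AtRel-≡ a)) x)
  Corr-Occ⁻¹ (rInp a r)         (inj₂ (i , x))      = inj₂ (i , Corr-Occ⁻¹ (r i) x)
  Corr-Occ⁻¹ (rOut a os r)      (inj₁ x)            = inj₁ (subst P (sym (AtRel-≡ a)) x)
  Corr-Occ⁻¹ (rOut a os r)      (inj₂ (i , inj₁ x)) = inj₂ (i , inj₁ (subst P (sym (AtRel-≡ (os i))) x))
  Corr-Occ⁻¹ (rOut a os r)      (inj₂ (i , inj₂ x)) = inj₂ (i , inj₂ (Corr-Occ⁻¹ (r i) x))
  Corr-Occ⁻¹ (rPar r s)         (inj₁ x)            = inj₁ (Corr-Occ⁻¹ r x)
  Corr-Occ⁻¹ (rPar r s)         (inj₂ x)            = inj₂ (Corr-Occ⁻¹ s x)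
  Corr-Occ⁻¹ (rRes r)           x                   = Corr-Occ⁻¹ r x
  Corr-Occ⁻¹ (rCnd {φ' = φ'} {T' = T'} f r) x =
    ⊎-map (subst (occFm P) (sym (FmRel-≡ f))) (Corr-Occ⁻¹ r) (Occ-guarded⁻¹ true φ' T' x)
  Corr-Occ⁻¹ (rRepIn a r)       (inj₁ x)            = inj₁ (subst P (sym (AtRel-≡ a)) x)
  Corr-Occ⁻¹ (rRepIn a r)       (inj₂ x)            = inj₂ (Corr-Occ⁻¹ r x)
  Corr-Occ⁻¹ (rRepOut a b r)    (inj₁ x)            = inj₁ (subst P (sym (AtRel-≡ a)) x)
  Corr-Occ⁻¹ (rRepOut a b r)    (inj₂ (inj₁ x))     = inj₂ (inj₁ (subst P (sym (AtRel-≡ b)) x))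
  Corr-Occ⁻¹ (rRepOut a b r)    (inj₂ (inj₂ x))     = inj₂ (inj₂ (Corr-Occ⁻¹ r x))

Fresh-transfer : ∀ {top n X Y} c → Corr _≡_ top {n} X Y → π.Fresh c Y → πᵛ.Fresh c X
Fresh-transfer c r fresh = fresh ∘ Corr-Occ r

≡⇒update-≡ : ∀ {c x y} → x ≡ y → update _≡_ c c x y
≡⇒update-≡ {c} {x} refl with x ≟ c
... | yes refl = inj₁ (refl , refl)
... | no  x≢c  = inj₂ (x≢c , x≢c , refl)

update-≡⇒≡ : ∀ {c x y} → update _≡_ c c x y → x ≡ y
update-≡⇒≡ (inj₁ (refl , refl)) = refl
update-≡⇒≡ (inj₂ (_ , _ , x≡y)) = x≡y

Corr-closeT-≡ : ∀ {top X Y} c → Corr _≡_ top X Y → Corr _≡_ top (πᵛ.closeT c X) (π.closeT c Y)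
Corr-closeT-≡ c r = Corr-closeT c c (Corr-map ≡⇒update-≡ r)

Corr-openT-≡ : ∀ {top B B'} c → Corr _≡_ top B B' → π.Fresh c B' →
               Corr _≡_ top (πᵛ.openT c B) (π.openT c B')
Corr-openT-≡ c r fresh = Corr-map update-≡⇒≡ (Corr-openT c c r (Fresh-transfer c r fresh) fresh)

-- πᵛ transitions are matched by π transitions

-- For a bound output, any name fresh for Y may serve as the extruded name; R pairs it with
-- the bound name of X.
Mimics : NameRel → π.Term 0 → Act → πᵛ.Term 0 → Set
Mimics R Y (lab (inL a b)) X' = ∀ b' → R b b' → ∃ λ a' → ∃ λ Y' →
  R a a' × Y π.⟶[ lab (inL a' b') ] Y' × Corr R true X' Y'
Mimics R Y (lab (outL a b)) X' = ∃ λ a' → ∃ λ b' → ∃ λ Y' →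
  R a a' × R b b' × Y π.⟶[ lab (outL a' b') ] Y' × Corr R true X' Y'
Mimics R Y (lab (boutL a c)) X' = ∀ c' → π.Fresh c' Y → ∃ λ a' → ∃ λ Y' →
  R a a' × Y π.⟶[ lab (boutL a' c') ] Y' × Corr (update R c c') true X' Y'
Mimics R Y τ X' = ∃ λ Y' → Y π.⟶[ τ ] Y' × Corr R true X' Y'

Corr-padded : ∀ {R X Y W} → Corr R true X Y → Padded Y W → Corr R true X W
Corr-padded r pad-refl       = r
Corr-padded r (pad-parL p D) = rPadL (Corr-padded r p) D
Corr-padded r (pad-parR p D) = rPadR (Corr-padded r p) D

Mimics-lift : ∀ {R Y Y' X'} α →
              (∀ {β W} → Y π.⟶[ β ] W → π.BoundOK β Y' → ∃ λ W' → Y' π.⟶[ β ] W' × Padded W W') →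
              (∀ {c} → π.Occ (isNm c) Y → π.Occ (isNm c) Y') →
              Mimics R Y α X' → Mimics R Y' α X'
Mimics-lift (lab (inL a b)) step occ m b' rb with m b' rb
... | a' , _ , ra , D , r with step D tt
...   | _ , D' , p = a' , _ , ra , D' , Corr-padded r p
Mimics-lift (lab (outL a b)) step occ (a' , b' , _ , ra , rb , D , r) with step D tt
... | _ , D' , p = a' , b' , _ , ra , rb , D' , Corr-padded r p
Mimics-lift (lab (boutL a c)) step occ m c' fresh' with m c' (fresh' ∘ occ)
... | a' , _ , ra , D , r with step D fresh'
...   | _ , D' , p = a' , _ , ra , D' , Corr-padded r p
Mimics-lift τ step occ (_ , D , r) with step D tt
... | _ , D' , p = _ , D' , Corr-padded r p

Mimics-padL : ∀ {R Y G X'} α → Dead G → Mimics R Y α X' → Mimics R (π.par Y G) α X'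
Mimics-padL α D =
  Mimics-lift α (λ {β} d ok → _ , π.parL d (BoundOK-mono β inj₂ ok) , pad-parL pad-refl D) inj₁

Mimics-padR : ∀ {R Y G X'} α → Dead G → Mimics R Y α X' → Mimics R (π.par G Y) α X'
Mimics-padR α D =
  Mimics-lift α (λ {β} d ok → _ , π.parR d (BoundOK-mono β inj₁ ok) , pad-parR pad-refl D) inj₂

Mimics-guarded : ∀ {R Z X'} α (φ : Fm 0) → evalFm φ ≡ just true → Mimics R Z α X' →
                 Mimics R (guarded true φ Z) α X'
Mimics-guarded {Z = Z} α φ e = Mimics-lift α (guarded-step true φ e) (Occ-guarded-body true φ Z)

update-keep : ∀ {R a b c c'} → R a b → a ≢ c → b ≢ c' → update R c c' a b
update-keep r a≢c b≢c' = inj₂ (a≢c , b≢c' , r)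

update-old : ∀ {R a b c c'} → update R c c' a b → a ≢ c → R a b × b ≢ c'
update-old (inj₁ (refl , _))        a≢a = ⊥-elim (a≢a refl)
update-old (inj₂ (_ , b≢c' , r)) _   = r , b≢c'

update-new : ∀ {R b c c'} → update R c c' c b → b ≡ c'
update-new (inj₁ (_ , b≡c'))  = b≡c'
update-new (inj₂ (c≢c , _)) = ⊥-elim (c≢c refl)

update-swap : ∀ {R d d' c c' x y} → d ≢ c → d' ≢ c' →
              update (update R d d') c c' x y → update (update R c c') d d' x y
update-swap d≢c d'≢c' (inj₁ (refl , refl)) = inj₂ (≢-sym d≢c , ≢-sym d'≢c' , inj₁ (refl , refl))
update-swap _   _     (inj₂ (_ , _ , inj₁ (refl , refl))) = inj₁ (refl , refl)
update-swap _   _     (inj₂ (x≢c , y≢c' , inj₂ (x≢d , y≢d' , r))) =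
  inj₂ (x≢d , y≢d' , inj₂ (x≢c , y≢c' , r))

Mimics-parL : ∀ {R S' T T' X₀} α → Mimics R S' α X₀ → Corr R true T T' → πᵛ.BoundOK α T →
              Mimics R (π.par S' T') α (πᵛ.par X₀ T)
Mimics-parL (lab (inL a b)) m r ok b' rb with m b' rb
... | a' , _ , ra , D , r' = a' , _ , ra , π.parL D tt , rPar r' r
Mimics-parL (lab (outL a b)) (a' , b' , _ , ra , rb , D , r') r ok =
  a' , b' , _ , ra , rb , π.parL D tt , rPar r' r
Mimics-parL {R} (lab (boutL a c)) m r ok c' fresh' with m c' (fresh' ∘ inj₁)
... | a' , _ , ra , D , r' =
  a' , _ , ra , π.parL D (fresh' ∘ inj₂) ,
  rPar r' (Corr-restrict c c' (update-keep {R}) r ok (fresh' ∘ inj₂))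
Mimics-parL τ (_ , D , r') r ok = _ , π.parL D tt , rPar r' r

Mimics-parR : ∀ {R S S' T' X₀} α → Mimics R T' α X₀ → Corr R true S S' → πᵛ.BoundOK α S →
              Mimics R (π.par S' T') α (πᵛ.par S X₀)
Mimics-parR (lab (inL a b)) m r ok b' rb with m b' rb
... | a' , _ , ra , D , r' = a' , _ , ra , π.parR D tt , rPar r r'
Mimics-parR (lab (outL a b)) (a' , b' , _ , ra , rb , D , r') r ok =
  a' , b' , _ , ra , rb , π.parR D tt , rPar r r'
Mimics-parR {R} (lab (boutL a c)) m r ok c' fresh' with m c' (fresh' ∘ inj₂)
... | a' , _ , ra , D , r' =
  a' , _ , ra , π.parR D (fresh' ∘ inj₁) ,
  rPar (Corr-restrict c c' (update-keep {R}) r ok (fresh' ∘ inj₁)) r'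
Mimics-parR τ (_ , D , r') r ok = _ , π.parR D tt , rPar r r'

Mimics-res : ∀ {R B' T'} α d → d ∉act α →
             (∀ d' → π.Fresh d' B' → Mimics (update R d d') (π.openT d' B') α T') →
             Mimics R (π.res B') α (πᵛ.νT d T')
Mimics-res {R} {B'} (lab (inL a b)) d (d≢a , d≢b) m b' rb with fresh B' b'
... | d' , fd , b'<d' with m d' fd b' (update-keep {R} rb (≢-sym d≢b) (<⇒≢ b'<d'))
...   | a' , _ , ra , D , r with update-old {R} ra (≢-sym d≢a)
...     | ra' , a'≢d' =
  a' , _ , ra' , π.resS fd D (≢-sym a'≢d' , ≢-sym (<⇒≢ b'<d')) , rRes (Corr-closeT d d' r)
Mimics-res {R} {B'} (lab (outL a b)) d (d≢a , d≢b) m with fresh B' 0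
... | d' , fd , _ with m d' fd
...   | a' , b' , _ , ra , rb , D , r with update-old {R} ra (≢-sym d≢a) | update-old {R} rb (≢-sym d≢b)
...     | ra' , a'≢d' | rb' , b'≢d' =
  a' , b' , _ , ra' , rb' , π.resS fd D (≢-sym a'≢d' , ≢-sym b'≢d') , rRes (Corr-closeT d d' r)
Mimics-res {R} {B'} (lab (boutL a c)) d (d≢a , d≢c) m c' fresh' with fresh B' c'
... | d' , fd , c'<d' with m d' fd c' (Occπ.Fresh-openT B' (<⇒≢ c'<d') fresh')
...   | a' , _ , ra , D , r with update-old {R} ra (≢-sym d≢a)
...     | ra' , a'≢d' =
  a' , _ , ra' , π.resS fd D (≢-sym a'≢d' , ≢-sym (<⇒≢ c'<d')) ,
  rRes (Corr-closeT d d' (Corr-map (update-swap {R} d≢c (≢-sym (<⇒≢ c'<d'))) r))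
Mimics-res {R} {B'} τ d _ m with fresh B' 0
... | d' , fd , _ with m d' fd
...   | _ , D , r = _ , π.resS fd D tt , rRes (Corr-closeT d d' r)

AtRel-nm : ∀ {R b} (p q : At 0) → AtRel R p q → p ≡ nm b → ∃ λ b' → q ≡ nm b' × R b b'
AtRel-nm (nm a) (nm b') r refl = b' , refl , r

simulate-πᵛ : ∀ {R top X Y α X'} → PartialBij R → Corr R top X Y → X πᵛ.⟶[ α ] X' → Mimics R Y α X'
simulate-πᵛ {α = α} bij (rPadL r D) d = Mimics-padL α D (simulate-πᵛ bij r d)
simulate-πᵛ {α = α} bij (rPadR r D) d = Mimics-padR α D (simulate-πᵛ bij r d)
simulate-πᵛ bij (rInp {q = nm a'} ra rs) (πᵛ.inp i b) b' rb =
  a' , _ , ra , π.inp i b' , Corr-instantiate rb (rs i)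
simulate-πᵛ bij (rOut {q = nm a'} {o = o} {o'} ra os rs) (πᵛ.out i e) with AtRel-nm (o i) (o' i) (os i) e
... | b' , e' , rb = a' , b' , _ , ra , rb , π.out i e' , Corr-top (rs i)
simulate-πᵛ bij (rPar r s) (πᵛ.parL {α = α} d ok) = Mimics-parL α (simulate-πᵛ bij r d) (Corr-top s) ok
simulate-πᵛ bij (rPar r s) (πᵛ.parR {α = α} d ok) = Mimics-parR α (simulate-πᵛ bij s d) (Corr-top r) ok
simulate-πᵛ bij (rPar r s) (πᵛ.comL d e) with simulate-πᵛ bij s e
... | a' , b' , _ , ra , rb , e' , s' with simulate-πᵛ bij r d b' rb
...   | _ , _ , ra' , d' , r' rewrite functional bij ra' ra = _ , π.comL d' e' , rPar r' s'
simulate-πᵛ bij (rPar r s) (πᵛ.comR d e) with simulate-πᵛ bij r d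
... | a' , b' , _ , ra , rb , d' , r' with simulate-πᵛ bij s e b' rb
...   | _ , _ , ra' , e' , s' rewrite functional bij ra' ra = _ , π.comR d' e' , rPar r' s'
simulate-πᵛ {R} bij (rPar {S' = S'} {T' = T'} r s) (πᵛ.closL {c = c} d e fr) with fresh (π.par S' T') 0
... | c' , fc , _ with simulate-πᵛ (PartialBij-update c c' bij)
                         (Corr-restrict c c' (update-keep {R}) (Corr-top r) fr (fc ∘ inj₁))
                         d c' (inj₁ (refl , refl))
...   | _ , _ , ra″ , d' , r' with simulate-πᵛ bij s e c' (fc ∘ inj₂)
...     | _ , _ , ra' , e' , s' with functional bij (proj₁ (update-old {R} ra″ (Occπᵛ.bout-≢ e))) ra'
...       | refl = _ , π.closL d' e' (fc ∘ inj₁) , rRes (Corr-closeT c c' (rPar r' s'))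
simulate-πᵛ {R} bij (rPar {S' = S'} {T' = T'} r s) (πᵛ.closR {c = c} d e fr) with fresh (π.par S' T') 0
... | c' , fc , _ with simulate-πᵛ (PartialBij-update c c' bij)
                         (Corr-restrict c c' (update-keep {R}) (Corr-top s) fr (fc ∘ inj₂))
                         e c' (inj₁ (refl , refl))
...   | _ , _ , ra″ , e' , s' with simulate-πᵛ bij r d c' (fc ∘ inj₁)
...     | _ , _ , ra' , d' , r' with functional bij (proj₁ (update-old {R} ra″ (Occπᵛ.bout-≢ d))) ra'
...       | refl = _ , π.closR d' e' (fc ∘ inj₂) , rRes (Corr-closeT c c' (rPar r' s'))
simulate-πᵛ {R} bij (rRes r) (πᵛ.opn {c = c} fr a≢c d) c' fr'
  with simulate-πᵛ (PartialBij-update c c' bij) (Corr-openT c c' r fr fr') d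
... | a' , _ , _ , ra , rc , d' , r' with update-old {R} ra a≢c | update-new {R} rc
...   | ra' , a'≢c' | refl = a' , _ , ra' , π.opn fr' a'≢c' d' , r'
simulate-πᵛ bij (rRes r) (πᵛ.resS {α = α} {c = d} fr D d∉α) =
  Mimics-res α d d∉α (λ d' fd → simulate-πᵛ (PartialBij-update d d' bij) (Corr-openT d d' r fr fd) D)
simulate-πᵛ {α = α} bij (rCnd {φ' = φ'} f r) (πᵛ.cond h d) =
  Mimics-guarded α φ' (trans (sym (evalFm-FmRel bij f)) h) (simulate-πᵛ bij r d)
simulate-πᵛ bij (rRepOut {q = nm a'} {q' = nm b'} ra rb r) πᵛ.repO =
  a' , b' , _ , ra , rb , π.repO , rPar (Corr-top r) (rRepOut ra rb r)
simulate-πᵛ bij (rRepIn {q = nm a'} ra r) (πᵛ.repI b) b' rb =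
  a' , _ , ra , π.repI b' , rPar (Corr-instantiate rb r) (rRepIn ra r)

-- π transitions are matched by πᵛ transitions

BoundOK-transfer : ∀ {top X Y} α → Corr _≡_ top X Y → π.BoundOK α Y → πᵛ.BoundOK α X
BoundOK-transfer (lab (inL a b))   r ok = tt
BoundOK-transfer (lab (outL a b))  r ok = tt
BoundOK-transfer (lab (boutL a c)) r ok = Fresh-transfer c r ok
BoundOK-transfer τ                 r ok = tt

Mimics⁻¹ : πᵛ.Term 0 → Act → π.Term 0 → Set
Mimics⁻¹ X α Y' = ∃ λ X' → X πᵛ.⟶[ α ] X' × Corr _≡_ true X' Y'

-- Recursion on a bound for the height of the π transition: the transition recovered from
-- a guard by guarded-step⁻¹ is lower but not a subterm.
simulate-π : ∀ n {top X Y α Y'} → Corr _≡_ top X Y → (D : Y π.⟶[ α ] Y') → height D < n → Mimics⁻¹ X α Y'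
simulate-π (suc n) (rPadL r G) (π.parL d _) lt with simulate-π n r d (s≤s⁻¹ lt)
... | _ , d' , r' = _ , d' , rPadL r' G
simulate-π (suc n) (rPadL r G) (π.parR d _)    lt = ⊥-elim (Dead⇒inert G d)
simulate-π (suc n) (rPadL r G) (π.comL _ d)    lt = ⊥-elim (Dead⇒inert G d)
simulate-π (suc n) (rPadL r G) (π.comR _ d)    lt = ⊥-elim (Dead⇒inert G d)
simulate-π (suc n) (rPadL r G) (π.closL _ d _) lt = ⊥-elim (Dead⇒inert G d)
simulate-π (suc n) (rPadL r G) (π.closR _ d _) lt = ⊥-elim (Dead⇒inert G d)
simulate-π (suc n) (rPadR r G) (π.parR d _) lt with simulate-π n r d (s≤s⁻¹ lt)
... | _ , d' , r' = _ , d' , rPadR r' G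
simulate-π (suc n) (rPadR r G) (π.parL d _)    lt = ⊥-elim (Dead⇒inert G d)
simulate-π (suc n) (rPadR r G) (π.comL d _)    lt = ⊥-elim (Dead⇒inert G d)
simulate-π (suc n) (rPadR r G) (π.comR d _)    lt = ⊥-elim (Dead⇒inert G d)
simulate-π (suc n) (rPadR r G) (π.closL d _ _) lt = ⊥-elim (Dead⇒inert G d)
simulate-π (suc n) (rPadR r G) (π.closR d _ _) lt = ⊥-elim (Dead⇒inert G d)
simulate-π (suc n) (rInp {p = nm a} refl rs) (π.inp i c) lt =
  _ , πᵛ.inp i c , Corr-instantiate refl (rs i)
simulate-π (suc n) (rOut {p = nm a} refl os rs) (π.out i e) lt =
  _ , πᵛ.out i (trans (AtRel-≡ (os i)) e) , Corr-top (rs i)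
simulate-π (suc n) (rPar r s) (π.parL {α = α} d ok) lt with simulate-π n r d (s≤s⁻¹ lt)
... | _ , d' , r' = _ , πᵛ.parL d' (BoundOK-transfer α s ok) , rPar r' (Corr-top s)
simulate-π (suc n) (rPar r s) (π.parR {α = α} d ok) lt with simulate-π n s d (s≤s⁻¹ lt)
... | _ , d' , s' = _ , πᵛ.parR d' (BoundOK-transfer α r ok) , rPar (Corr-top r) s'
simulate-π (suc n) (rPar r s) (π.comL d e) lt
  with simulate-π n r d (m⊔n<o⇒m<o _ _ (s≤s⁻¹ lt)) | simulate-π n s e (m⊔n<o⇒n<o _ _ (s≤s⁻¹ lt))
... | _ , d' , r' | _ , e' , s' = _ , πᵛ.comL d' e' , rPar r' s'
simulate-π (suc n) (rPar r s) (π.comR d e) lt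
  with simulate-π n r d (m⊔n<o⇒m<o _ _ (s≤s⁻¹ lt)) | simulate-π n s e (m⊔n<o⇒n<o _ _ (s≤s⁻¹ lt))
... | _ , d' , r' | _ , e' , s' = _ , πᵛ.comR d' e' , rPar r' s'
simulate-π (suc n) (rPar r s) (π.closL {c = c} d e fr) lt
  with simulate-π n r d (m⊔n<o⇒m<o _ _ (s≤s⁻¹ lt)) | simulate-π n s e (m⊔n<o⇒n<o _ _ (s≤s⁻¹ lt))
... | _ , d' , r' | _ , e' , s' =
  _ , πᵛ.closL d' e' (Fresh-transfer c r fr) , rRes (Corr-closeT-≡ c (rPar r' s'))
simulate-π (suc n) (rPar r s) (π.closR {c = c} d e fr) lt
  with simulate-π n r d (m⊔n<o⇒m<o _ _ (s≤s⁻¹ lt)) | simulate-π n s e (m⊔n<o⇒n<o _ _ (s≤s⁻¹ lt))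
... | _ , d' , r' | _ , e' , s' =
  _ , πᵛ.closR d' e' (Fresh-transfer c s fr) , rRes (Corr-closeT-≡ c (rPar r' s'))
simulate-π (suc n) (rRes r) (π.opn {c = c} fr a≢c d) lt
  with simulate-π n (Corr-openT-≡ c r fr) d (s≤s⁻¹ lt)
... | _ , d' , r' = _ , πᵛ.opn (Fresh-transfer c r fr) a≢c d' , r'
simulate-π (suc n) (rRes r) (π.resS {c = c} fr d c∉α) lt
  with simulate-π n (Corr-openT-≡ c r fr) d (s≤s⁻¹ lt)
... | _ , d' , r' = _ , πᵛ.resS (Fresh-transfer c r fr) d' c∉α , rRes (Corr-closeT-≡ c r')
simulate-π (suc n) (rCnd {φ' = φ'} f r) d lt with guarded-step⁻¹ true φ' d
... | e , _ , d₀ , p , lt₀ with simulate-π n r d₀ (<-≤-trans lt₀ (s≤s⁻¹ lt))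
...   | _ , d' , r' = _ , πᵛ.cond (trans (evalFm-FmRel PartialBij-≡ f) e) d' , Corr-padded r' p
simulate-π (suc n) (rRepOut {p = nm a} {p' = nm b} refl refl r) π.repO lt =
  _ , πᵛ.repO , rPar (Corr-top r) (rRepOut refl refl r)
simulate-π (suc n) (rRepIn {p = nm a} refl r) (π.repI b) lt =
  _ , πᵛ.repI b , rPar (Corr-instantiate refl r) (rRepIn refl r)

encode : ∀ {n} → πᵛ.Term n → π.Term n
encode πᵛ.nil              = π.nil
encode (πᵛ.inpSum p k f)   = π.inpSum p k (encode ∘ f)
encode (πᵛ.outSum p k o f) = π.outSum p k o (encode ∘ f)
encode (πᵛ.par S T)        = π.par (encode S) (encode T)
encode (πᵛ.res B)          = π.res (encode B)
encode (πᵛ.cnd φ T)        = guarded true φ (encode T)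
encode (πᵛ.repIn p B)      = π.repIn p (encode B)
encode (πᵛ.repOut p q T)   = π.repOut p q (encode T)

embed : ∀ {n} → π.Term n → πᵛ.Term n
embed π.nil                   = πᵛ.nil
embed (π.inpSum p k f)        = πᵛ.inpSum p k (embed ∘ f)
embed (π.outSum p k o f)      = πᵛ.outSum p k o (embed ∘ f)
embed (π.par S T)             = πᵛ.par (embed S) (embed T)
embed (π.res B)               = πᵛ.res (embed B)
embed (π.cnd (eqC p q) T)     = πᵛ.cnd (eqF p q) (embed T)
embed (π.cnd (neqC p q) T)    = πᵛ.cnd (notF (eqF p q)) (embed T)
embed (π.repIn p B)           = πᵛ.repIn p (embed B)
embed (π.repOut p q T)        = πᵛ.repOut p q (embed T)

FmRel-refl : ∀ {n} (φ : Fm n) → FmRel _≡_ φ φ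
FmRel-refl (eqF p q)  = eqR (AtRel-refl p) (AtRel-refl q)
FmRel-refl (andF φ ψ) = andR (FmRel-refl φ) (FmRel-refl ψ)
FmRel-refl (notF φ)   = notR (FmRel-refl φ)

Corr-encode : ∀ {n} (X : πᵛ.Term n) → Corr _≡_ false X (encode X)
Corr-encode πᵛ.nil              = rNil
Corr-encode (πᵛ.inpSum p k f)   = rInp (AtRel-refl p) (Corr-encode ∘ f)
Corr-encode (πᵛ.outSum p k o f) = rOut (AtRel-refl p) (AtRel-refl ∘ o) (Corr-encode ∘ f)
Corr-encode (πᵛ.par S T)        = rPar (Corr-encode S) (Corr-encode T)
Corr-encode (πᵛ.res B)          = rRes (Corr-encode B)
Corr-encode (πᵛ.cnd φ T)        = rCnd (FmRel-refl φ) (Corr-encode T)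
Corr-encode (πᵛ.repIn p B)      = rRepIn (AtRel-refl p) (Corr-encode B)
Corr-encode (πᵛ.repOut p q T)   = rRepOut (AtRel-refl p) (AtRel-refl q) (Corr-encode T)

Corr-embed : ∀ {n} (Y : π.Term n) → Corr _≡_ false (embed Y) Y
Corr-embed π.nil                = rNil
Corr-embed (π.inpSum p k f)     = rInp (AtRel-refl p) (Corr-embed ∘ f)
Corr-embed (π.outSum p k o f)   = rOut (AtRel-refl p) (AtRel-refl ∘ o) (Corr-embed ∘ f)
Corr-embed (π.par S T)          = rPar (Corr-embed S) (Corr-embed T)
Corr-embed (π.res B)            = rRes (Corr-embed B)
Corr-embed (π.cnd (eqC p q) T)  = rCnd (FmRel-refl (eqF p q)) (Corr-embed T)
Corr-embed (π.cnd (neqC p q) T) = rCnd (FmRel-refl (notF (eqF p q))) (Corr-embed T)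
Corr-embed (π.repIn p B)        = rRepIn (AtRel-refl p) (Corr-embed B)
Corr-embed (π.repOut p q T)     = rRepOut (AtRel-refl p) (AtRel-refl q) (Corr-embed T)

Corresponds : πᵛ.Term 0 → π.Term 0 → Set
Corresponds X Y = πᵛ.IsProc X × π.IsProc Y × Corr _≡_ true X Y

barb-π : ∀ {X Y X'} ℓ → Corr _≡_ true X Y → X πᵛ.⟶[ lab ℓ ] X' → Barb πCalc Y
barb-π (inL a b) r d with simulate-πᵛ PartialBij-≡ r d b refl
... | a' , Y' , _ , d' , _ = inL a' b , Y' , d'
barb-π (outL a b) r d with simulate-πᵛ PartialBij-≡ r d
... | a' , b' , Y' , _ , _ , d' , _ = outL a' b' , Y' , d'
barb-π {Y = Y} (boutL a c) r d with fresh Y 0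
... | c' , fc , _ with simulate-πᵛ PartialBij-≡ r d c' fc
...   | a' , Y' , _ , d' , _ = boutL a' c' , Y' , d'

correspondence : StrongCorrespondence πᵛCalc πCalc Corresponds
correspondence = record
  { onProcs    = λ (p , q , _) → p , q
  ; total      = λ X p → encode X , p , p ∘ Corr-Occ⁻¹ (Corr-encode X) , Corr-top (Corr-encode X)
  ; surjective = λ Y q → embed Y , q ∘ Corr-Occ (Corr-embed Y) , q , Corr-top (Corr-embed Y)
  ; forth      = λ (p , q , r) d →
      let _ , d' , r' = simulate-πᵛ PartialBij-≡ r d
      in _ , d' , Occπᵛ.IsProc-⟶ d p , Occπ.IsProc-⟶ d' q , r'
  ; back       = λ (p , q , r) d →
      let _ , d' , r' = simulate-π (suc (height d)) r d ≤-refl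
      in _ , d' , Occπᵛ.IsProc-⟶ d' p , Occπ.IsProc-⟶ d q , r'
  ; barb-forth = λ (_ , _ , r) (ℓ , _ , d) → barb-π ℓ r d
  ; barb-back  = λ (_ , _ , r) (ℓ , _ , d) →
      let X' , d' , _ = simulate-π (suc (height d)) r d ≤-refl in ℓ , X' , d'
  ; par-closed = λ (p , q , r) (p' , q' , r') → [ p , p' ] , [ q , q' ] , rPar r r'
  ; ν-closed   = λ {X} {Y} c (p , q , r) →
      Occπᵛ.IsProc-νT c X p , Occπ.IsProc-νT c Y q , rRes (Corr-closeT-≡ c r)
  }

proposition4p3 : (πCalc ⊑ πᵛCalc) × (πᵛCalc ⊑ πCalc)
proposition4p3 =
  StrongCorrespondence⇒⊑ (StrongCorrespondence-flip correspondence) ,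
  StrongCorrespondence⇒⊑ correspondence
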